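{- Let $n\ge4$ and let $S$ be an inductive strategy of length $n$ with $S\neq CSL$, i.e. $S[n]\neq[n,1,2,\dots,n-1]$. Then $[x^3]f_{CSL}(x)<[x^3]f_S(x)$.
   Context: Permutation wordle on $[n]=\{1,\dots,n\}$: a secret permutation $\pi\in S_n$ (one-line notation) is fixed. The first guess is $\gamma_1=[1,2,\dots,n]$. After guess $\gamma_r$ the guesser learns $\mathcal{J}_r=\{i:\gamma_r(i)=\pi(i)\}$; $\mathcal{I}_r=[n]\setminus\mathcal{J}_r$. The game ends at the first $r$ with $\mathcal{J}_r=[n]$. A strategy of length $n$ is a sequence $S=(S[1],\dots,S[n])$ with $S[k]$ a permutation of $[k]$; if $\mathcal{I}_r=\{i_1<\dots<i_k\}\neq\emptyset$ and $\sigma=S[k]$, then $\gamma_{r+1}(i)=\gamma_r(i)$ for $i\in\mathcal{J}_r$ and $\gamma_{r+1}(i_{\sigma(j)})=\gamma_r(i_j)$ for $j=1,\dots,k$. $f_S(x)=\sum_r a_rx^r$ where $a_r$ is the number of $\pi\in S_n$ for which the game with $S$ ends after exactly $r$ guesses. The cyclic shift strategy $CS$ has $CS[k]=[2,3,\dots,k,1]$. An inductive strategy of length $n$ has $S[k]=CS[k]$ for $1\le k\le n-1$ and $S[n]$ an arbitrary cyclic permutation (single $n$-cycle) of $[n]$. $CSL$ denotes the inductive strategy of length $n$ with $CSL[n]=[n,1,2,\dots,n-1]$. -}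

module Defs where

open import Data.Nat using (ℕ; zero; suc; _+_; _≟_)
open import Data.Nat.DivMod using (_mod_)
open import Data.Fin using (Fin; toℕ) renaming (_≟_ to _≟ᶠ_)
open import Data.Fin.Properties using (all?)
open import Data.Fin.Permutation using (Permutation′; _⟨$⟩ʳ_)
open import Data.List using (List; []; _∷_; length; filter; map; concatMap; lookup; foldr; allFin)
open import Data.Vec using (Vec; []; _∷_) renaming (lookup to vlookup)
open import Data.Vec.Functional using (Vector; updateAt)
open import Data.Product using (_×_; ∃)
open import Function using (const)
open import Relation.Binary.PropositionalEquality using (_≡_; refl)
open import Relation.Nullary using (Dec; yes; no; ¬_; ¬?; _×-dec_; _→-dec_)

-- Conventions: [n] = {1..n} is represented by Fin n (0-based), so the
-- value/position j+1 of the paper is the element j of Fin n.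
-- A guess / secret permutation is a function Fin n → Fin n (one-line notation).

-- A strategy of length n: for each k, a map S[k] : Fin k → Fin k
-- (only k = 1..n is ever used; k = 0 never triggers any change).
Strategy : Set
Strategy = (k : ℕ) → Fin k → Fin k

-- Cyclic shift CS[k] = [2,3,...,k,1]:  j ↦ j+1 (mod k)
cs : ∀ {k} → Fin k → Fin k
cs {suc k} i = suc (toℕ i) mod suc k

-- CSL[n] = [n,1,2,...,n-1]:  j ↦ j-1 (mod n)
csl : ∀ {n} → Fin n → Fin n
csl {suc k} i = (toℕ i + k) mod suc k

indStrat : (n : ℕ) → (Fin n → Fin n) → Strategy
indStrat n σ k with k ≟ n
... | yes refl = σ
... | no _     = cs

CSL : (n : ℕ) → Strategy
CSL n = indStrat n csl

iter : ∀ {n} → (Fin n → Fin n) → ℕ → Fin n → Fin n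
iter f zero    x = x
iter f (suc m) x = f (iter f m x)

IsCyclic : ∀ {n} → Permutation′ n → Set
IsCyclic {n} σ = ∀ (i j : Fin n) → ∃ λ m → iter (σ ⟨$⟩ʳ_) m i ≡ j

-- I = {i₁ < … < i_k} is the list of positions where γ and π disagree (increasing),
-- and γ'(i_{σ(j)}) = γ(i_j) with σ = S[k]; positions in J are unchanged.
wrong : ∀ {n} → Vector (Fin n) n → Vector (Fin n) n → List (Fin n)
wrong {n} γ π = filter (λ i → ¬? (γ i ≟ᶠ π i)) (allFin n)

next : ∀ {n} → Strategy → Vector (Fin n) n → Vector (Fin n) n → Vector (Fin n) n
next S γ π =
  let I   = wrong γ π
      idx = lookup I
      σ   = S (length I)
  in foldr (λ j g → updateAt g (idx (σ j)) (const (γ (idx j)))) γ (allFin (length I))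

guess : ∀ {n} → Strategy → Vector (Fin n) n → ℕ → Vector (Fin n) n
guess S π zero    = λ i → i                     -- unused index 0: also the identity
guess S π (suc zero) = λ i → i
guess S π (suc (suc r)) = next S (guess S π (suc r)) π

Solved : ∀ {n} → Vector (Fin n) n → Vector (Fin n) n → Set
Solved γ π = ∀ i → γ i ≡ π i

solved? : ∀ {n} (γ π : Vector (Fin n) n) → Dec (Solved γ π)
solved? γ π = all? (λ i → γ i ≟ᶠ π i)

IsPerm : ∀ {n} → Vector (Fin n) n → Set
IsPerm π = ∀ i j → π i ≡ π j → i ≡ j

isPerm? : ∀ {n} (π : Vector (Fin n) n) → Dec (IsPerm π)
isPerm? π = all? (λ i → all? (λ j → (π i ≟ᶠ π j) →-dec (i ≟ᶠ j)))

Ends3 : ∀ {n} → Strategy → Vector (Fin n) n → Set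
Ends3 S π = ¬ Solved (guess S π 1) π × ¬ Solved (guess S π 2) π × Solved (guess S π 3) π

ends3? : ∀ {n} (S : Strategy) (π : Vector (Fin n) n) → Dec (Ends3 S π)
ends3? S π = ¬? (solved? _ π) ×-dec ¬? (solved? _ π) ×-dec solved? _ π

allVecs : (n m : ℕ) → List (Vec (Fin n) m)
allVecs n zero    = [] ∷ []
allVecs n (suc m) = concatMap (λ i → map (i ∷_) (allVecs n m)) (allFin n)

-- [x^3] f_S(x): the number of π ∈ S_n for which the game ends after exactly 3 guesses.
coeff3 : (n : ℕ) → Strategy → ℕ
coeff3 n S = length (filter (λ v → isPerm? (vlookup v) ×-dec ends3? S (vlookup v)) (allVecs n n))

-- Write h = σ⁻¹ and let cs be the cyclic successor on positions.  For an inductive strategy the second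
-- guess on a derangement π is h (for CSL it is cs), and the game ends after exactly three guesses iff
-- either π = h ∘ h, or the set Q of positions where π and h differ has at least two elements, misses some
-- position, and π is h with its values moved one step forward along Q; derangement of π then says that no
-- a ∈ Q has h a as its successor in Q (for CSL: no two cyclically adjacent positions lie in Q).
-- Permutations with a fixed point end after three guesses under every inductive strategy alike.
-- A CSL-class Q is sent to the σ-class Q ∪ {cs a : a ∈ Q whose successor in Q is h a}.  This map is
-- injective since Q can be recovered by walking backwards around the circle, and it misses the class of a
-- two- or three-point set of consecutive positions (depending on whether h = csl); here n ≥ 4 is needed.

module Submission where

open import Defs
open import Data.Nat using (ℕ; zero; suc; _+_; _∸_; _≤_; _<_; _≥_; z≤n; s≤s; _≤?_; _<?_; s≤s⁻¹) renaming (_≟_ to _≟ℕ_)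
open import Data.Nat.Properties hiding (_≟_)
open import Data.Nat.DivMod using (_%_; m<n⇒m%n≡m; n%n≡0; [m+n]%n≡m%n)
open import Data.Fin using (Fin; toℕ; _≟_; cast) renaming (zero to fzero; suc to fsuc)
open import Data.Fin.Properties using (toℕ-fromℕ<; toℕ-injective; toℕ<n; toℕ≤pred[n]; all?; any?; ¬∀⟶∃¬; cast-is-id; injective⇒≤)
open import Data.Fin.Permutation using (Permutation′; _⟨$⟩ʳ_; _⟨$⟩ˡ_; inverseˡ; inverseʳ)
open import Data.List using (List; []; _∷_; length; filter; lookup; allFin; foldr; map)
open import Data.List.Properties using (filter-all; filter-notAll; filter-≐; length-tabulate; lookup-tabulate)
open import Data.List.Membership.Propositional using (_∈_)
open import Data.List.Membership.Propositional.Properties using (∈-filter⁺; ∈-filter⁻; ∈-allFin; ∈-lookup; ∈-map⁺; ∈-map⁻; ∈-concatMap⁺)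
open import Data.List.Relation.Unary.Any as Any using (here; there; index)
open import Data.List.Relation.Unary.Any.Properties using (lookup-index)
open import Data.List.Relation.Unary.All as All using (All)
import Data.List.Relation.Unary.All.Properties as All
open import Data.List.Relation.Unary.AllPairs as AllPairs using (AllPairs; []; _∷_)
import Data.List.Relation.Unary.AllPairs.Properties as AllPairs
open import Data.List.Relation.Unary.Unique.Propositional using (Unique)
import Data.List.Relation.Unary.Unique.Propositional.Properties as Unique
open import Data.List.Relation.Binary.Disjoint.Propositional using (Disjoint)
open import Data.Vec using (Vec; []; _∷_; tabulate) renaming (lookup to vlookup)
open import Data.Vec.Properties using (lookup∘tabulate; tabulate∘lookup; tabulate-cong; ∷-injective)
open import Data.Vec.Functional using (Vector; updateAt)
open import Data.Vec.Functional.Properties using (updateAt-updates; updateAt-minimal)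
open import Data.Product using (_×_; _,_; proj₁; proj₂; ∃)
open import Data.Sum using (_⊎_; inj₁; inj₂)
open import Data.Empty using (⊥; ⊥-elim)
open import Function using (id; const; _∘′_)
open import Level using (0ℓ)
open import Relation.Nullary using (¬_; Dec; yes; no; ¬?; _×-dec_; _→-dec_; _⊎-dec_)
open import Relation.Nullary.Decidable using (map′; toSum; decidable-stable)
open import Relation.Unary using (Pred; Decidable; _⊆_)
open import Relation.Binary.PropositionalEquality
open import Relation.Binary.Definitions using (tri<; tri≈; tri>)

-- Cyclic order on Fin (suc k)

module _ {k : ℕ} where

  toℕ-cs : (x : Fin (suc k)) → toℕ (cs x) ≡ suc (toℕ x) % suc k
  toℕ-cs x = toℕ-fromℕ< _

  toℕ-csl : (x : Fin (suc k)) → toℕ (csl x) ≡ (toℕ x + k) % suc k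
  toℕ-csl x = toℕ-fromℕ< _

  toℕ-cs-< : (x : Fin (suc k)) → toℕ x < k → toℕ (cs x) ≡ suc (toℕ x)
  toℕ-cs-< x x<k = trans (toℕ-cs x) (m<n⇒m%n≡m (s≤s x<k))

  toℕ-cs-last : (x : Fin (suc k)) → toℕ x ≡ k → toℕ (cs x) ≡ 0
  toℕ-cs-last x x≡k = trans (toℕ-cs x) (trans (cong (λ t → suc t % suc k) x≡k) (n%n≡0 (suc k)))

  toℕ-csl-zero : (x : Fin (suc k)) → toℕ x ≡ 0 → toℕ (csl x) ≡ k
  toℕ-csl-zero x x≡0 = trans (toℕ-csl x) (trans (cong (λ t → (t + k) % suc k) x≡0) (m<n⇒m%n≡m (n<1+n k)))

  toℕ-csl-suc : (x : Fin (suc k)) (t : ℕ) → toℕ x ≡ suc t → toℕ (csl x) ≡ t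
  toℕ-csl-suc x t x≡1+t = begin
    toℕ (csl x)         ≡⟨ toℕ-csl x ⟩
    (toℕ x + k) % suc k ≡⟨ cong (λ u → (u + k) % suc k) x≡1+t ⟩
    (suc t + k) % suc k ≡⟨ cong (_% suc k) (sym (+-suc t k)) ⟩
    (t + suc k) % suc k ≡⟨ [m+n]%n≡m%n t (suc k) ⟩
    t % suc k           ≡⟨ m<n⇒m%n≡m (<-trans (n<1+n t) (subst (_< suc k) x≡1+t (toℕ<n x))) ⟩
    t                   ∎
    where open ≡-Reasoning

  cs-csl : (x : Fin (suc k)) → cs (csl x) ≡ x
  cs-csl x = by-toℕ (toℕ x) refl
    where
    by-toℕ : (u : ℕ) → toℕ x ≡ u → cs (csl x) ≡ x
    by-toℕ zero    x≡0 = toℕ-injective (trans (toℕ-cs-last (csl x) (toℕ-csl-zero x x≡0)) (sym x≡0))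
    by-toℕ (suc t) x≡1+t =
      toℕ-injective (trans (toℕ-cs-< (csl x) csl-x<k) (trans (cong suc (toℕ-csl-suc x t x≡1+t)) (sym x≡1+t)))
      where
      csl-x<k : toℕ (csl x) < k
      csl-x<k rewrite toℕ-csl-suc x t x≡1+t = s≤s⁻¹ (subst (_< suc k) x≡1+t (toℕ<n x))

  csl-cs : (x : Fin (suc k)) → csl (cs x) ≡ x
  csl-cs x with <-cmp (toℕ x) k
  ... | tri< x<k _ _ = toℕ-injective (toℕ-csl-suc (cs x) (toℕ x) (toℕ-cs-< x x<k))
  ... | tri≈ _ x≡k _ = toℕ-injective (trans (toℕ-csl-zero (cs x) (toℕ-cs-last x x≡k)) (sym x≡k))
  ... | tri> _ _ x>k = ⊥-elim (<⇒≱ x>k (toℕ≤pred[n] x))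

  cs-injective : {x y : Fin (suc k)} → cs x ≡ cs y → x ≡ y
  cs-injective {x} {y} eq = trans (sym (csl-cs x)) (trans (cong csl eq) (csl-cs y))

-- The clockwise distance from a to c on ℤ/n, for a c < n.
distℕ : ℕ → ℕ → ℕ → ℕ
distℕ n a c with a ≤? c
... | yes _ = c ∸ a
... | no _  = n ∸ a + c

module _ (n : ℕ) where

  distℕ-≤ : ∀ {a c} → a ≤ c → distℕ n a c ≡ c ∸ a
  distℕ-≤ {a} {c} a≤c with a ≤? c
  ... | yes _  = refl
  ... | no a≰c = ⊥-elim (a≰c a≤c)

  distℕ-> : ∀ {a c} → c < a → distℕ n a c ≡ n ∸ a + c
  distℕ-> {a} {c} c<a with a ≤? c
  ... | yes a≤c = ⊥-elim (<⇒≱ c<a a≤c)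
  ... | no _    = refl

  distℕ<n : ∀ {a c} → a < n → c < n → distℕ n a c < n
  distℕ<n {a} {c} a<n c<n with a ≤? c
  ... | yes _  = ≤-<-trans (m∸n≤m c a) c<n
  ... | no a≰c = begin-strict
    n ∸ a + c <⟨ +-monoʳ-< (n ∸ a) (≰⇒> a≰c) ⟩
    n ∸ a + a ≡⟨ m∸n+n≡m (<⇒≤ a<n) ⟩
    n         ∎
    where open ≤-Reasoning

  distℕ-self : ∀ a → distℕ n a a ≡ 0
  distℕ-self a = trans (distℕ-≤ {a} ≤-refl) (n∸n≡0 a)

  distℕ≡0⇒≡ : ∀ {a c} → a < n → distℕ n a c ≡ 0 → a ≡ c
  distℕ≡0⇒≡ {a} {c} a<n d≡0 with a ≤? c
  ... | yes a≤c = ≤-antisym a≤c (m∸n≡0⇒m≤n d≡0)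
  ... | no _    = ⊥-elim (<⇒≢ (m<n⇒0<n∸m a<n) (sym (m+n≡0⇒m≡0 (n ∸ a) d≡0)))

  distℕ-injective : ∀ {a b c} → b < n → c < n → distℕ n a b ≡ distℕ n a c → b ≡ c
  distℕ-injective {a} {b} {c} b<n c<n eq with a ≤? b | a ≤? c
  ... | yes a≤b | yes a≤c = ∸-cancelʳ-≡ a≤b a≤c eq
  ... | no _    | no _    = +-cancelˡ-≡ (n ∸ a) b c eq
  ... | yes a≤b | no _    = ⊥-elim (<-irrefl eq (<-≤-trans (∸-monoˡ-< b<n a≤b) (m≤m+n (n ∸ a) c)))
  ... | no _    | yes a≤c = ⊥-elim (<-irrefl (sym eq) (<-≤-trans (∸-monoˡ-< c<n a≤c) (m≤m+n (n ∸ a) b)))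

  distℕ-suc : ∀ {a c} → suc c ≢ a → distℕ n a (suc c) ≡ suc (distℕ n a c)
  distℕ-suc {a} {c} 1+c≢a with a ≤? c
  ... | yes a≤c = trans (distℕ-≤ (m≤n⇒m≤1+n a≤c)) (+-∸-assoc 1 a≤c)
  ... | no a≰c  = trans (distℕ-> (≤∧≢⇒< (≰⇒> a≰c) 1+c≢a)) (+-suc (n ∸ a) c)

  distℕ-from-suc : ∀ {a c} → c ≢ a → suc a < n → distℕ n a c ≡ suc (distℕ n (suc a) c)
  distℕ-from-suc {a} {c} c≢a 1+a<n with a ≤? c
  ... | yes a≤c = trans (+-∸-assoc 1 a<c) (cong suc (sym (distℕ-≤ a<c)))
    where
    a<c : a < c
    a<c = ≤∧≢⇒< a≤c (λ a≡c → c≢a (sym a≡c))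
  ... | no a≰c  = trans (cong (_+ c) (+-∸-assoc 1 (<⇒≤ 1+a<n)))
                        (cong suc (sym (distℕ-> (m≤n⇒m≤1+n (≰⇒> a≰c)))))

distℕ-wrap : ∀ {k a} → 0 < a → a ≤ k → distℕ (suc k) a 0 ≡ suc (distℕ (suc k) a k)
distℕ-wrap {k} {a} 0<a a≤k =
  trans (distℕ-> (suc k) 0<a) (trans (+-identityʳ _) (trans (+-∸-assoc 1 a≤k) (cong suc (sym (distℕ-≤ (suc k) a≤k)))))

distℕ-from-last : ∀ {k c} → c < k → distℕ (suc k) k c ≡ suc (distℕ (suc k) 0 c)
distℕ-from-last {k} {c} c<k = trans (distℕ-> (suc k) c<k) (cong (_+ c) (trans (+-∸-assoc 1 {k} ≤-refl) (cong suc (n∸n≡0 k))))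

iter-suc′ : ∀ {n} (f : Fin n → Fin n) (t : ℕ) (x : Fin n) → iter f (suc t) x ≡ iter f t (f x)
iter-suc′ f zero    x = refl
iter-suc′ f (suc t) x = cong f (iter-suc′ f t x)

module _ {k : ℕ} where

  dist : Fin (suc k) → Fin (suc k) → ℕ
  dist a c = distℕ (suc k) (toℕ a) (toℕ c)

  dist<n : (a c : Fin (suc k)) → dist a c < suc k
  dist<n a c = distℕ<n (suc k) (toℕ<n a) (toℕ<n c)

  dist≤k : (a c : Fin (suc k)) → dist a c ≤ k
  dist≤k a c = s≤s⁻¹ (dist<n a c)

  dist-self : (a : Fin (suc k)) → dist a a ≡ 0
  dist-self a = distℕ-self (suc k) (toℕ a)

  dist≡0⇒≡ : {a c : Fin (suc k)} → dist a c ≡ 0 → a ≡ c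
  dist≡0⇒≡ {a} d≡0 = toℕ-injective (distℕ≡0⇒≡ (suc k) (toℕ<n a) d≡0)

  dist-injective : (a : Fin (suc k)) {b c : Fin (suc k)} → dist a b ≡ dist a c → b ≡ c
  dist-injective a {b} {c} eq = toℕ-injective (distℕ-injective (suc k) {toℕ a} (toℕ<n b) (toℕ<n c) eq)

  dist-cs : (a y : Fin (suc k)) → cs y ≢ a → dist a (cs y) ≡ suc (dist a y)
  dist-cs a y cy≢a with <-cmp (toℕ y) k
  ... | tri< y<k _ _ rewrite toℕ-cs-< y y<k = distℕ-suc (suc k) (λ eq → cy≢a (toℕ-injective (trans (toℕ-cs-< y y<k) eq)))
  ... | tri≈ _ y≡k _ = wrap (toℕ-cs-last y y≡k) y≡k 0<a
    where
    0<a : 0 < toℕ a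
    0<a = n≢0⇒n>0 (λ a≡0 → cy≢a (toℕ-injective (trans (toℕ-cs-last y y≡k) (sym a≡0))))
    wrap : toℕ (cs y) ≡ 0 → toℕ y ≡ k → 0 < toℕ a → dist a (cs y) ≡ suc (dist a y)
    wrap cy≡0 y≡k′ 0<a′ rewrite cy≡0 | y≡k′ = distℕ-wrap 0<a′ (toℕ≤pred[n] a)
  ... | tri> _ _ y>k = ⊥-elim (<⇒≱ y>k (toℕ≤pred[n] y))

  dist-from-cs : (x c : Fin (suc k)) → c ≢ x → dist x c ≡ suc (dist (cs x) c)
  dist-from-cs x c c≢x with <-cmp (toℕ x) k
  ... | tri< x<k _ _ rewrite toℕ-cs-< x x<k = distℕ-from-suc (suc k) (λ eq → c≢x (toℕ-injective eq)) (s≤s x<k)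
  ... | tri≈ _ x≡k _ rewrite toℕ-cs-last x x≡k | x≡k =
    distℕ-from-last (≤∧≢⇒< (toℕ≤pred[n] c) (λ c≡k → c≢x (toℕ-injective (trans c≡k (sym x≡k)))))
  ... | tri> _ _ x>k = ⊥-elim (<⇒≱ x>k (toℕ≤pred[n] x))

  dist-csl : (a : Fin (suc k)) → dist a (csl a) ≡ k
  dist-csl a = by-toℕ (toℕ a) refl
    where
    by-toℕ : (u : ℕ) → toℕ a ≡ u → dist a (csl a) ≡ k
    by-toℕ zero    a≡0 rewrite toℕ-csl-zero a a≡0 | a≡0 = refl
    by-toℕ (suc t) a≡1+t rewrite toℕ-csl-suc a t a≡1+t | a≡1+t =
      trans (distℕ-> (suc k) (n<1+n t)) (m∸n+n≡m (≤-trans (n≤1+n t) (subst (_≤ k) a≡1+t (toℕ≤pred[n] a))))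

  dist-iter-cs : (a : Fin (suc k)) (t : ℕ) → t ≤ k → dist a (iter cs t a) ≡ t
  dist-iter-cs a zero    _   = dist-self a
  dist-iter-cs a (suc t) t<k with cs (iter cs t a) ≟ a
  ... | no  ≢a = trans (dist-cs a _ ≢a) (cong suc (dist-iter-cs a t (<⇒≤ t<k)))
  ... | yes ≡a = ⊥-elim (<-irrefl dist≡k t<k)
    where
    dist≡k : t ≡ k
    dist≡k = begin
      t                        ≡⟨ dist-iter-cs a t (<⇒≤ t<k) ⟨
      dist a (iter cs t a)     ≡⟨ cong (dist a) (sym (csl-cs _)) ⟩
      dist a (csl (cs (iter cs t a))) ≡⟨ cong (λ z → dist a (csl z)) ≡a ⟩
      dist a (csl a)           ≡⟨ dist-csl a ⟩
      k                        ∎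
      where open ≡-Reasoning

  iter-cs≢ : (a : Fin (suc k)) (t : ℕ) → 0 < t → t ≤ k → iter cs t a ≢ a
  iter-cs≢ a t 0<t t≤k eq = <⇒≢ 0<t (sym (trans (sym (dist-iter-cs a t t≤k)) (trans (cong (dist a) eq) (dist-self a))))

  cs≢ : 1 ≤ k → (a : Fin (suc k)) → cs a ≢ a
  cs≢ 1≤k a = iter-cs≢ a 1 (s≤s z≤n) 1≤k

  iter-cs-dist : (x z : Fin (suc k)) → iter cs (dist x z) x ≡ z
  iter-cs-dist x z = dist-injective x (dist-iter-cs x (dist x z) (dist≤k x z))

  iter-csl-dist : (z x : Fin (suc k)) → iter csl (dist z x) x ≡ z
  iter-csl-dist z x = by-dist (dist z x) x refl
    where
    by-dist : (t : ℕ) (x : Fin (suc k)) → dist z x ≡ t → iter csl t x ≡ z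
    by-dist zero    x d≡0 = sym (dist≡0⇒≡ d≡0)
    by-dist (suc t) x d≡1+t = trans (iter-suc′ csl t x) (by-dist t (csl x) (suc-injective (begin
      suc (dist z (csl x))  ≡⟨ dist-cs z (csl x) cslx≢z ⟨
      dist z (cs (csl x))   ≡⟨ cong (dist z) (cs-csl x) ⟩
      dist z x              ≡⟨ d≡1+t ⟩
      suc t                 ∎)))
      where
      open ≡-Reasoning
      cslx≢z : cs (csl x) ≢ z
      cslx≢z eq = 0≢1+n (trans (sym (dist-self z)) (trans (cong (dist z) (trans (sym eq) (cs-csl x))) d≡1+t))

  dist-pos : {a c : Fin (suc k)} → c ≢ a → 0 < dist a c
  dist-pos c≢a = n≢0⇒n>0 (λ d≡0 → c≢a (sym (dist≡0⇒≡ d≡0)))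

  -- c lies strictly inside the clockwise arc from a to b, which is the whole circle when b = a.
  Between : Fin (suc k) → Fin (suc k) → Fin (suc k) → Set
  Between a b c = 0 < dist a c × (dist a c < dist a b ⊎ a ≡ b)

  between? : (a b c : Fin (suc k)) → Dec (Between a b c)
  between? a b c = (0 <? dist a c) ×-dec ((dist a c <? dist a b) ⊎-dec (a ≟ b))

  Between⇒≢ : {a b c : Fin (suc k)} → Between a b c → c ≢ a
  Between⇒≢ {a} (0<d , _) refl = <-irrefl (sym (dist-self a)) 0<d

  ¬Between-cs : 1 ≤ k → (a c : Fin (suc k)) → ¬ Between a (cs a) c
  ¬Between-cs 1≤k a c (0<d , inj₁ d<1) =
    <-irrefl refl (<-≤-trans 0<d (s≤s⁻¹ (subst (dist a c <_) (trans (dist-cs a a (cs≢ 1≤k a)) (cong suc (dist-self a))) d<1)))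
  ¬Between-cs 1≤k a c (_ , inj₂ a≡ca) = cs≢ 1≤k a (sym a≡ca)

  Between-pred : {a y : Fin (suc k)} → y ≢ a → Between a (cs y) y
  Between-pred {a} {y} y≢a with cs y ≟ a
  ... | yes cy≡a = dist-pos y≢a , inj₂ (sym cy≡a)
  ... | no cy≢a  = dist-pos y≢a , inj₁ (subst (dist a y <_) (sym (dist-cs a y cy≢a)) (n<1+n _))

  Between-from-cs : {x b c : Fin (suc k)} → b ≢ cs x → Between (cs x) b c → Between x b c
  Between-from-cs b≢cx (_ , inj₂ cx≡b) = ⊥-elim (b≢cx (sym cx≡b))
  Between-from-cs {x} {b} {c} b≢cx (_ , inj₁ d<d) = dist-pos c≢x , d<d′
    where
    c≢x : c ≢ x
    c≢x refl = <⇒≱ d<d (subst (_≥ dist (cs c) b) (sym dist-to-c) (dist≤k (cs c) b))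
      where
      dist-to-c : dist (cs c) c ≡ k
      dist-to-c = trans (cong (dist (cs c)) (sym (csl-cs c))) (dist-csl (cs c))
    d<d′ : dist x c < dist x b ⊎ x ≡ b
    d<d′ with b ≟ x
    ... | yes b≡x = inj₂ (sym b≡x)
    ... | no b≢x  = inj₁ (subst₂ _<_ (sym (dist-from-cs x c c≢x)) (sym (dist-from-cs x b b≢x)) (s≤s d<d))

  Between-trans : {a b c d : Fin (suc k)} → Between a b c → Between a c d → Between a b d
  Between-trans abc (_ , inj₂ a≡c) = ⊥-elim (Between⇒≢ abc (sym a≡c))
  Between-trans (_ , inj₁ c<b) (0<d , inj₁ d<c) = 0<d , inj₁ (<-trans d<c c<b)
  Between-trans (_ , inj₂ a≡b) (0<d , inj₁ _)   = 0<d , inj₂ a≡b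

  Between-total : {a b b′ : Fin (suc k)} → b ≢ a → b′ ≢ a → b ≢ b′ → Between a b b′ ⊎ Between a b′ b
  Between-total {a} {b} {b′} b≢a b′≢a b≢b′ with <-cmp (dist a b) (dist a b′)
  ... | tri< lt _ _ = inj₂ (dist-pos b≢a , inj₁ lt)
  ... | tri≈ _ eq _ = ⊥-elim (b≢b′ (dist-injective a eq))
  ... | tri> _ _ gt = inj₁ (dist-pos b′≢a , inj₁ gt)

  Between-csl : {u c : Fin (suc k)} → c ≢ u → c ≢ csl u → Between u (csl u) c
  Between-csl {u} {c} c≢u c≢pu =
    dist-pos c≢u , inj₁ (≤∧≢⇒< (subst (dist u c ≤_) (sym (dist-csl u)) (dist≤k u c)) (λ eq → c≢pu (dist-injective u eq)))

  Between-cs-cs : 2 ≤ k → {y c : Fin (suc k)} → Between y (cs (cs y)) c → c ≡ cs y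
  Between-cs-cs 2≤k {y} (_ , inj₂ y≡ccy) = ⊥-elim (iter-cs≢ y 2 (s≤s z≤n) 2≤k (sym y≡ccy))
  Between-cs-cs 2≤k {y} {c} (0<d , inj₁ d<d) =
    dist-injective y (trans (dist≡1 (dist y c) 0<d (subst (dist y c <_) (dist-iter-cs y 2 2≤k) d<d))
                            (sym (dist-iter-cs y 1 (≤-trans (s≤s z≤n) 2≤k))))
    where
    dist≡1 : ∀ m → 0 < m → m < 2 → m ≡ 1
    dist≡1 (suc zero) _ _ = refl
    dist≡1 (suc (suc _)) _ (s≤s (s≤s ()))

  Between-toℕ-< : {a b c : Fin (suc k)} → toℕ a < toℕ b → Between a b c → toℕ a < toℕ c × toℕ c < toℕ b
  Between-toℕ-< a<b (_ , inj₂ a≡b) = ⊥-elim (<-irrefl (cong toℕ a≡b) a<b)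
  Between-toℕ-< {a} {b} {c} a<b (0<d , inj₁ d<d) with ≤-<-connex (toℕ a) (toℕ c)
  ... | inj₁ a≤c = m∸n≢0⇒n<m (λ c-a≡0 → <-irrefl (sym (trans (distℕ-≤ (suc k) a≤c) c-a≡0)) 0<d)
                , ≰⇒> (λ b≤c → <⇒≱ c-a<b-a (∸-monoˡ-≤ (toℕ a) b≤c))
    where
    c-a<b-a : toℕ c ∸ toℕ a < toℕ b ∸ toℕ a
    c-a<b-a = subst₂ _<_ (distℕ-≤ (suc k) a≤c) (distℕ-≤ (suc k) (<⇒≤ a<b)) d<d
  ... | inj₂ c<a = ⊥-elim (<⇒≱ wrapped<b-a (≤-trans (∸-monoˡ-≤ (toℕ a) (<⇒≤ (toℕ<n b))) (m≤m+n _ _)))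
    where
    wrapped<b-a : suc k ∸ toℕ a + toℕ c < toℕ b ∸ toℕ a
    wrapped<b-a = subst₂ _<_ (distℕ-> (suc k) c<a) (distℕ-≤ (suc k) (<⇒≤ a<b)) d<d

  Between-toℕ-≥ : {a b c : Fin (suc k)} → toℕ b ≤ toℕ a → Between a b c → toℕ a < toℕ c ⊎ toℕ c < toℕ b
  Between-toℕ-≥ {a} {b} {c} b≤a abc@(_ , d<d) with ≤-<-connex (toℕ a) (toℕ c)
  ... | inj₁ a≤c = inj₁ (≤∧≢⇒< a≤c (λ a≡c → Between⇒≢ abc (toℕ-injective (sym a≡c))))
  ... | inj₂ c<a with d<d | a ≟ b
  ...   | inj₂ refl | _        = inj₂ c<a
  ...   | inj₁ _    | yes refl = inj₂ c<a
  ...   | inj₁ d<d′ | no a≢b = inj₂ (+-cancelˡ-< (suc k ∸ toℕ a) (toℕ c) (toℕ b)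
                                    (subst₂ _<_ (distℕ-> (suc k) c<a) (distℕ-> (suc k) b<a) d<d′))
    where
    b<a : toℕ b < toℕ a
    b<a = ≤∧≢⇒< b≤a (λ b≡a → a≢b (toℕ-injective (sym b≡a)))

module _ {k : ℕ} {τ : Fin (suc k) → Fin (suc k)} (cyclic : ∀ i j → ∃ λ m → iter τ m i ≡ j) where

  cyclic-no-fixed-point : 1 ≤ k → ∀ x → τ x ≢ x
  cyclic-no-fixed-point 1≤k x τx≡x = cs≢ 1≤k x (sym (trans (sym (stays (proj₁ (cyclic x (cs x))))) (proj₂ (cyclic x (cs x)))))
    where
    stays : ∀ m → iter τ m x ≡ x
    stays zero    = refl
    stays (suc m) = trans (cong τ (stays m)) τx≡x

  cyclic-no-2-cycle : 2 ≤ k → ∀ x → τ (τ x) ≢ x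
  cyclic-no-2-cycle 2≤k x ττx≡x = missed (orbit (proj₁ (cyclic x target)))
    where
    orbit : ∀ m → iter τ m x ≡ x ⊎ iter τ m x ≡ τ x
    orbit zero    = inj₁ refl
    orbit (suc m) with orbit m
    ... | inj₁ eq = inj₂ (cong τ eq)
    ... | inj₂ eq = inj₁ (trans (cong τ eq) ττx≡x)
    target : Fin (suc k)
    target with cs x ≟ τ x
    ... | yes _ = cs (cs x)
    ... | no _  = cs x
    target≢ : target ≢ x × target ≢ τ x
    target≢ with cs x ≟ τ x
    ... | yes cx≡τx = iter-cs≢ x 2 (s≤s z≤n) 2≤k ,
                      λ ccx≡τx → cs≢ (≤-trans (s≤s z≤n) 2≤k) (cs x) (trans ccx≡τx (sym cx≡τx))
    ... | no cx≢τx  = cs≢ (≤-trans (s≤s z≤n) 2≤k) x , cx≢τx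
    missed : iter τ (proj₁ (cyclic x target)) x ≡ x ⊎ iter τ (proj₁ (cyclic x target)) x ≡ τ x → ⊥
    missed (inj₁ eq) = proj₁ target≢ (trans (sym (proj₂ (cyclic x target))) eq)
    missed (inj₂ eq) = proj₂ target≢ (trans (sym (proj₂ (cyclic x target))) eq)

-- Successors inside a subset

module _ {k : ℕ} where

  record NextIn (P : Pred (Fin (suc k)) 0ℓ) (a b : Fin (suc k)) : Set where
    constructor nextIn
    field
      from∈   : P a
      to∈     : P b
      from≢to : a ≢ b
      gap     : ∀ c → Between a b c → ¬ P c

  open NextIn public

  nextIn? : {P : Pred (Fin (suc k)) 0ℓ} → Decidable P → ∀ a b → Dec (NextIn P a b)
  nextIn? P? a b = map′ (λ (pa , pb , a≢b , gap) → nextIn pa pb a≢b gap) (λ (nextIn pa pb a≢b gap) → pa , pb , a≢b , gap)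
    (P? a ×-dec P? b ×-dec ¬? (a ≟ b) ×-dec all? (λ c → between? a b c →-dec ¬? (P? c)))

  NextIn-functional : {P : Pred (Fin (suc k)) 0ℓ} {a b b′ : Fin (suc k)} → NextIn P a b → NextIn P a b′ → b ≡ b′
  NextIn-functional {a = a} {b} {b′} ab ab′ with b ≟ b′
  ... | yes b≡b′ = b≡b′
  ... | no b≢b′ with Between-total (≢-sym (from≢to ab)) (≢-sym (from≢to ab′)) b≢b′
  ...   | inj₁ b′∈ab = ⊥-elim (gap ab b′ b′∈ab (to∈ ab′))
  ...   | inj₂ b∈ab′ = ⊥-elim (gap ab′ b b∈ab′ (to∈ ab))

  NextIn-map : {P Q : Pred (Fin (suc k)) 0ℓ} → P ⊆ Q → Q ⊆ P → {a b : Fin (suc k)} → NextIn P a b → NextIn Q a b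
  NextIn-map P⊆Q Q⊆P (nextIn pa pb a≢b gap) = nextIn (P⊆Q pa) (P⊆Q pb) a≢b (λ c c∈ qc → gap c c∈ (Q⊆P qc))

  NextIn-cs : 1 ≤ k → {P : Pred (Fin (suc k)) 0ℓ} {a : Fin (suc k)} → P a → P (cs a) → NextIn P a (cs a)
  NextIn-cs 1≤k {a = a} pa pca = nextIn pa pca (≢-sym (cs≢ 1≤k a)) (λ c c∈ _ → ¬Between-cs 1≤k a c c∈)

  Avoids : (Fin (suc k) → Fin (suc k)) → Pred (Fin (suc k)) 0ℓ → Set
  Avoids g P = ∀ {a b} → NextIn P a b → b ≢ g a

  Separated : Pred (Fin (suc k)) 0ℓ → Set
  Separated P = ∀ {a} → P a → ¬ P (cs a)

  Avoids-cs⇒Separated : 1 ≤ k → {P : Pred (Fin (suc k)) 0ℓ} → Avoids cs P → Separated P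
  Avoids-cs⇒Separated 1≤k avoids pa pca = avoids (NextIn-cs 1≤k pa pca) refl

module Extension {k : ℕ} (h : Fin (suc k) → Fin (suc k)) (P : Pred (Fin (suc k)) 0ℓ) where

  NextIsImage : Pred (Fin (suc k)) 0ℓ
  NextIsImage a = NextIn P a (h a)

  extend : Pred (Fin (suc k)) 0ℓ
  extend x = P x ⊎ NextIsImage (csl x)

  extend? : Decidable P → Decidable extend
  extend? P? x = P? x ⊎-dec nextIn? P? (csl x) (h (csl x))

  private
    next-is-image⇒avoids : 1 ≤ k → Avoids cs P → ∀ {a b} → NextIn extend a b → NextIsImage a → b ≢ h a
    next-is-image⇒avoids 1≤k avoids {a} ab image b≡ha = avoids image (trans (sym b≡ha) b≡ca)
      where
      b≡ca : _ ≡ cs a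
      b≡ca = NextIn-functional ab (NextIn-cs 1≤k (inj₁ (from∈ image)) (inj₂ (subst NextIsImage (sym (csl-cs a)) image)))

    from-P⇒avoids : ∀ {a b} → NextIn extend a b → ¬ NextIsImage a → P a → b ≢ h a
    from-P⇒avoids {a} ab ¬image pa refl with to∈ ab
    ... | inj₁ pb     = ¬image (nextIn pa pb (from≢to ab) (λ c c∈ pc → gap ab c c∈ (inj₁ pc)))
    ... | inj₂ image′ =
      gap ab (csl (h a)) (subst (λ z → Between a z (csl (h a))) (cs-csl (h a)) (Between-pred p≢a)) (inj₁ (from∈ image′))
      where
      p≢a : csl (h a) ≢ a
      p≢a p≡a = ¬image (subst NextIsImage p≡a image′)

    added⇒avoids : 1 ≤ k → (∀ {x y} → h x ≡ h y → x ≡ y) → Avoids cs P →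
                   ∀ {a b} → NextIn extend a b → ¬ NextIsImage a → ¬ P a → b ≢ h a
    added⇒avoids 1≤k h-inj avoids {a} {b} ab ¬image ¬pa b≡ha =
      cs≢ 1≤k x (trans (cs-csl a) (sym (h-inj (trans (sym b≡hx) b≡ha))))
      where
      x : Fin (suc k)
      x = csl a
      image : NextIsImage x
      image with from∈ ab
      ... | inj₁ pa     = ⊥-elim (¬pa pa)
      ... | inj₂ image′ = image′
      hx≢cx : h x ≢ cs x
      hx≢cx = avoids image
      a≡cx : a ≡ cs x
      a≡cx = sym (cs-csl a)
      in-gap : ∀ {c} → Between a (h x) c → extend c → ∃ λ d → Between x (h x) d × P d
      in-gap {c} a<c<hx (inj₁ pc)     = c , x<c<hx , pc
        where
        x<c<hx : Between x (h x) c
        x<c<hx = Between-from-cs hx≢cx (subst (λ z → Between z (h x) c) a≡cx a<c<hx)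
      in-gap {c} a<c<hx (inj₂ image′) = csl c , Between-trans x<c<hx x<pc<c , from∈ image′
        where
        x<c<hx : Between x (h x) c
        x<c<hx = Between-from-cs hx≢cx (subst (λ z → Between z (h x) c) a≡cx a<c<hx)
        pc≢x : csl c ≢ x
        pc≢x pc≡x = Between⇒≢ a<c<hx (trans (sym (cs-csl c)) (trans (cong cs pc≡x) (sym a≡cx)))
        x<pc<c : Between x c (csl c)
        x<pc<c = subst (λ z → Between x z (csl c)) (cs-csl c) (Between-pred pc≢x)
      gap′ : ∀ c → Between a (h x) c → ¬ extend c
      gap′ c a<c<hx ec = let (d , d∈ , pd) = in-gap a<c<hx ec in gap image d d∈ pd
      b≡hx : b ≡ h x
      b≡hx = NextIn-functional ab (nextIn (from∈ ab) (inj₁ (to∈ image)) (λ a≡hx → hx≢cx (trans (sym a≡hx) a≡cx)) gap′)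

  extend-avoids : Decidable P → 1 ≤ k → (∀ {x y} → h x ≡ h y → x ≡ y) → Avoids cs P → Avoids h extend
  extend-avoids P? 1≤k h-inj avoids {a} ab with nextIn? P? a (h a) | P? a
  ... | yes image | _      = next-is-image⇒avoids 1≤k avoids ab image
  ... | no ¬image | yes pa = from-P⇒avoids ab ¬image pa
  ... | no ¬image | no ¬pa = added⇒avoids 1≤k h-inj avoids ab ¬image ¬pa

  private
    full⇒σ-closed : 2 ≤ k → {σ : Fin (suc k) → Fin (suc k)} → (∀ y → σ (h y) ≡ y) → Avoids cs P →
                    (∀ x → extend x) → ∀ {c} → P c → P (σ c)
    full⇒σ-closed 2≤k {σ} σ∘h avoids full {c} pc = subst P (sym σc≡y) (from∈ image)
      where
      separated : Separated P
      separated = Avoids-cs⇒Separated (≤-trans (s≤s z≤n) 2≤k) avoids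
      ¬p-pc : ¬ P (csl c)
      ¬p-pc p-pc = separated p-pc (subst P (sym (cs-csl c)) pc)
      y : Fin (suc k)
      y = csl (csl c)
      image : NextIsImage y
      image with full (csl c)
      ... | inj₁ p-pc  = ⊥-elim (¬p-pc p-pc)
      ... | inj₂ image = image
      ccy≡c : cs (cs y) ≡ c
      ccy≡c = trans (cong cs (cs-csl (csl c))) (cs-csl c)
      y-to-c : NextIn P y c
      y-to-c = nextIn (from∈ image) pc (λ y≡c → iter-cs≢ y 2 (s≤s z≤n) 2≤k (trans ccy≡c (sym y≡c)))
        λ d y<d<c pd → ¬p-pc (subst P (trans (Between-cs-cs 2≤k (subst (λ z → Between y z d) (sym ccy≡c) y<d<c)) (cs-csl (csl c))) pd)
      σc≡y : σ c ≡ y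
      σc≡y = trans (cong σ (sym (NextIn-functional image y-to-c))) (σ∘h y)

  extend-nonfull : Decidable P → 2 ≤ k → {σ : Fin (suc k) → Fin (suc k)} → (∀ y → σ (h y) ≡ y) →
                   (∀ i j → ∃ λ m → iter σ m i ≡ j) →
                   Avoids cs P → ∀ {a} → P a → ∃ λ z → ¬ extend z
  extend-nonfull P? 2≤k {σ} σ∘h cyclic avoids {a} pa with all? (extend? P?)
  ... | no ¬full = ¬∀⟶∃¬ (suc k) extend (extend? P?) ¬full
  ... | yes full = ⊥-elim (Avoids-cs⇒Separated (≤-trans (s≤s z≤n) 2≤k) avoids pa
                             (subst P (proj₂ (cyclic a (cs a))) (orbit (proj₁ (cyclic a (cs a))))))
    where
    orbit : ∀ m → P (iter σ m a)
    orbit zero    = pa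
    orbit (suc m) = full⇒σ-closed 2≤k {σ} σ∘h avoids full (orbit m)

module _ {k : ℕ} (h : Fin (suc k) → Fin (suc k)) where
  open Extension h using (extend)

  private
    extend-step : {P Q : Pred (Fin (suc k)) 0ℓ} → Separated P → extend P ⊆ extend Q →
                  ∀ {y} → P y → ¬ Q y → Q (csl y) × ¬ P (csl y)
    extend-step {P} separated P⊆Q {y} py ¬qy with P⊆Q (inj₁ py)
    ... | inj₁ qy    = ⊥-elim (¬qy qy)
    ... | inj₂ image = from∈ image , λ p-py → separated p-py (subst P (sym (cs-csl y)) py)

  extend-injective : 1 ≤ k → {P Q : Pred (Fin (suc k)) 0ℓ} → Decidable Q → Avoids cs P → Avoids cs Q →
                     extend P ⊆ extend Q → extend Q ⊆ extend P → (∃ λ z → ¬ extend P z) → P ⊆ Q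
  extend-injective 1≤k {P} {Q} Q? avoidsP avoidsQ P⊆Q Q⊆P (z , ¬ez) {x} px with Q? x
  ... | yes qx = qx
  ... | no ¬qx = ⊥-elim (¬ez (subst (extend P) (iter-csl-dist z x) (in-extend (differ (dist z x)))))
    where
    Differ : Fin (suc k) → Set
    Differ y = (P y × ¬ Q y) ⊎ (Q y × ¬ P y)
    differ : ∀ t → Differ (iter csl t x)
    differ zero = inj₁ (px , ¬qx)
    differ (suc t) with differ t
    ... | inj₁ (py , ¬qy) = inj₂ (extend-step (Avoids-cs⇒Separated 1≤k avoidsP) P⊆Q py ¬qy)
    ... | inj₂ (qy , ¬py) = inj₁ (extend-step (Avoids-cs⇒Separated 1≤k avoidsQ) Q⊆P qy ¬py)
    in-extend : ∀ {y} → Differ y → extend P y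
    in-extend (inj₁ (py , _)) = inj₁ py
    in-extend (inj₂ (qy , _)) = Q⊆P (inj₁ qy)

record TwoIn {k : ℕ} (P : Pred (Fin (suc k)) 0ℓ) : Set where
  constructor twoIn
  field
    fst snd : Fin (suc k)
    fst≢snd : fst ≢ snd
    fst∈    : P fst
    snd∈    : P snd

TwoIn-⊆ : ∀ {k} {P Q : Pred (Fin (suc k)) 0ℓ} → P ⊆ Q → TwoIn P → TwoIn Q
TwoIn-⊆ P⊆Q (twoIn u v u≢v pu pv) = twoIn u v u≢v (P⊆Q pu) (P⊆Q pv)

NextIn⇒TwoIn : ∀ {k} {P : Pred (Fin (suc k)) 0ℓ} {a b} → NextIn P a b → TwoIn P
NextIn⇒TwoIn ab = twoIn _ _ (from≢to ab) (from∈ ab) (to∈ ab)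

third-point : {A : Set} {a b c u v : A} → a ≢ b → a ≢ c → b ≢ c →
              (u ≡ a ⊎ u ≡ b ⊎ u ≡ c) → (v ≡ a ⊎ v ≡ b ⊎ v ≡ c) → u ≢ v →
              ∃ λ w → (w ≡ a ⊎ w ≡ b ⊎ w ≡ c) × w ≢ u × w ≢ v
third-point {a = a} {b} {c} a≢b a≢c b≢c = third
  where
  third : ∀ {u v} → (u ≡ a ⊎ u ≡ b ⊎ u ≡ c) → (v ≡ a ⊎ v ≡ b ⊎ v ≡ c) → u ≢ v →
          ∃ λ w → (w ≡ a ⊎ w ≡ b ⊎ w ≡ c) × w ≢ u × w ≢ v
  third (inj₁ refl)        (inj₁ refl)        u≢v = ⊥-elim (u≢v refl)
  third (inj₁ refl)        (inj₂ (inj₁ refl)) _   = c , inj₂ (inj₂ refl) , ≢-sym a≢c , ≢-sym b≢c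
  third (inj₁ refl)        (inj₂ (inj₂ refl)) _   = b , inj₂ (inj₁ refl) , ≢-sym a≢b , b≢c
  third (inj₂ (inj₁ refl)) (inj₁ refl)        _   = c , inj₂ (inj₂ refl) , ≢-sym b≢c , ≢-sym a≢c
  third (inj₂ (inj₁ refl)) (inj₂ (inj₁ refl)) u≢v = ⊥-elim (u≢v refl)
  third (inj₂ (inj₁ refl)) (inj₂ (inj₂ refl)) _   = a , inj₁ refl , a≢b , a≢c
  third (inj₂ (inj₂ refl)) (inj₁ refl)        _   = b , inj₂ (inj₁ refl) , b≢c , ≢-sym a≢b
  third (inj₂ (inj₂ refl)) (inj₂ (inj₁ refl)) _   = a , inj₁ refl , a≢c , a≢b
  third (inj₂ (inj₂ refl)) (inj₂ (inj₂ refl)) u≢v = ⊥-elim (u≢v refl)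

record Witness {k : ℕ} (h : Fin (suc k) → Fin (suc k)) : Set₁ where
  open Extension h using (extend)
  field
    W             : Pred (Fin (suc k)) 0ℓ
    W?            : Decidable W
    two           : TwoIn W
    outside       : Fin (suc k)
    ¬W-outside    : ¬ W outside
    avoids        : Avoids h W
    not-extension : ∀ {P} → Avoids cs P → extend P ⊆ W → W ⊆ extend P → ¬ TwoIn P

module _ {k : ℕ} (3≤k : 3 ≤ k) (h : Fin (suc k) → Fin (suc k)) (h-inj : ∀ {x y} → h x ≡ h y → x ≡ y) where
  open Extension h using (extend)

  private
    1≤k : 1 ≤ k
    1≤k = ≤-trans (s≤s z≤n) 3≤k
    2≤k : 2 ≤ k
    2≤k = ≤-trans (s≤s (s≤s z≤n)) 3≤k

  witness-adjacent : ∀ x → h x ≢ cs x → h (cs x) ≢ x → Witness h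
  witness-adjacent x hx≢cx hcx≢x = record
    { W = W ; W? = λ c → (c ≟ x) ⊎-dec (c ≟ cs x)
    ; two = twoIn x (cs x) (≢-sym (cs≢ 1≤k x)) (inj₁ refl) (inj₂ refl)
    ; outside = cs (cs x) ; ¬W-outside = ¬W-ccx ; avoids = avoids ; not-extension = not-extension }
    where
    W : Pred (Fin (suc k)) 0ℓ
    W c = c ≡ x ⊎ c ≡ cs x
    ¬W-ccx : ¬ W (cs (cs x))
    ¬W-ccx (inj₁ ccx≡x)  = iter-cs≢ x 2 (s≤s z≤n) 2≤k ccx≡x
    ¬W-ccx (inj₂ ccx≡cx) = cs≢ 1≤k x (cs-injective ccx≡cx)
    avoids : Avoids h W
    avoids (nextIn (inj₁ refl) (inj₁ refl) a≢b _) = ⊥-elim (a≢b refl)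
    avoids (nextIn (inj₁ refl) (inj₂ refl) _ _)   = ≢-sym hx≢cx
    avoids (nextIn (inj₂ refl) (inj₁ refl) _ _)   = ≢-sym hcx≢x
    avoids (nextIn (inj₂ refl) (inj₂ refl) a≢b _) = ⊥-elim (a≢b refl)
    not-extension : ∀ {P} → Avoids cs P → extend P ⊆ W → W ⊆ extend P → ¬ TwoIn P
    not-extension {P} avoidsP P⊆W _ (twoIn u v u≢v pu pv) with P⊆W (inj₁ pu) | P⊆W (inj₁ pv)
    ... | inj₁ refl | inj₁ refl = u≢v refl
    ... | inj₂ refl | inj₂ refl = u≢v refl
    ... | inj₁ refl | inj₂ refl = Avoids-cs⇒Separated 1≤k avoidsP pu pv
    ... | inj₂ refl | inj₁ refl = Avoids-cs⇒Separated 1≤k avoidsP pv pu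

  witness-csl : (∀ x → h (cs x) ≡ x) → Fin (suc k) → Witness h
  witness-csl h∘cs a = record
    { W = W ; W? = λ c → (c ≟ a) ⊎-dec ((c ≟ cs a) ⊎-dec (c ≟ cs (cs a)))
    ; two = twoIn a (cs a) (≢-sym a≢ca) (inj₁ refl) (inj₂ (inj₁ refl))
    ; outside = cs (cs (cs a)) ; ¬W-outside = ¬W-cccx ; avoids = avoids ; not-extension = not-extension }
    where
    W : Pred (Fin (suc k)) 0ℓ
    W c = c ≡ a ⊎ c ≡ cs a ⊎ c ≡ cs (cs a)
    a≢ca : cs a ≢ a
    a≢ca = cs≢ 1≤k a
    a≢cca : cs (cs a) ≢ a
    a≢cca = iter-cs≢ a 2 (s≤s z≤n) 2≤k
    ¬W-cccx : ¬ W (cs (cs (cs a)))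
    ¬W-cccx (inj₁ eq)        = iter-cs≢ a 3 (s≤s z≤n) 3≤k eq
    ¬W-cccx (inj₂ (inj₁ eq)) = a≢cca (cs-injective eq)
    ¬W-cccx (inj₂ (inj₂ eq)) = a≢ca (cs-injective (cs-injective eq))
    h≡csl : ∀ u → h u ≡ csl u
    h≡csl u = trans (cong h (sym (cs-csl u))) (h∘cs (csl u))
    avoids : Avoids h W
    avoids {u} {v} (nextIn wu wv u≢v gap) v≡hu
      with third-point (≢-sym a≢ca) (≢-sym a≢cca) (≢-sym (a≢ca ∘′ cs-injective)) wu wv u≢v
    ... | w , ww , w≢u , w≢v =
      gap w (subst (λ z → Between u z w) (sym v≡pu) (Between-csl w≢u (λ w≡pu → w≢v (trans w≡pu (sym v≡pu))))) ww
      where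
      v≡pu : v ≡ csl u
      v≡pu = trans v≡hu (h≡csl u)
    not-extension : ∀ {P} → Avoids cs P → extend P ⊆ W → W ⊆ extend P → ¬ TwoIn P
    not-extension {P} avoidsP _ W⊆P′ _ = separated (W⊆P (inj₁ refl)) (W⊆P (inj₂ (inj₁ refl)))
      where
      separated : Separated P
      separated = Avoids-cs⇒Separated 1≤k avoidsP
      ¬image : ∀ y → ¬ Extension.NextIsImage h P y
      ¬image y image = separated (subst P (h≡csl y) (to∈ image)) (subst P (sym (cs-csl y)) (from∈ image))
      W⊆P : W ⊆ P
      W⊆P wc with W⊆P′ wc
      ... | inj₁ pc    = pc
      ... | inj₂ image = ⊥-elim (¬image _ image)

  witness : (∃ λ x → h x ≢ cs x) → Witness h
  witness (x₀ , hx₀≢cx₀) with any? (λ x → ¬? (h x ≟ cs x) ×-dec ¬? (h (cs x) ≟ x))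
  ... | yes (x , hx≢cx , hcx≢x) = witness-adjacent x hx≢cx hcx≢x
  ... | no ¬adjacent = witness-csl h∘cs x₀
    where
    forced : ∀ x → h x ≢ cs x → h (cs x) ≡ x
    forced x hx≢cx with h (cs x) ≟ x
    ... | yes eq = eq
    ... | no neq = ⊥-elim (¬adjacent (x , hx≢cx , neq))
    propagate : ∀ y → h y ≡ cs y → h (cs y) ≡ cs (cs y)
    propagate y hy≡cy with h (cs y) ≟ cs (cs y)
    ... | yes eq  = eq
    ... | no neq = ⊥-elim (iter-cs≢ y 2 (s≤s z≤n) 2≤k (h-inj (trans (forced (cs y) neq) (sym hy≡cy))))
    h∘cs : ∀ x → h (cs x) ≡ x
    h∘cs x with h x ≟ cs x
    ... | no hx≢cx  = forced x hx≢cx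
    ... | yes hx≡cx = ⊥-elim (hx₀≢cx₀ (subst (λ z → h z ≡ cs z) (iter-cs-dist x x₀) (along (dist x x₀))))
      where
      along : ∀ t → h (iter cs t x) ≡ cs (iter cs t x)
      along zero    = hx≡cx
      along (suc t) = propagate _ (along t)

-- Sorted enumerations

module _ {A : Set} where

  AllPairs-lookup : ∀ {R : A → A → Set} {xs} → AllPairs R xs → ∀ {i j} → toℕ i < toℕ j → R (lookup xs i) (lookup xs j)
  AllPairs-lookup (Rx ∷ _)   {fzero}  {fsuc j} _         = All.lookup Rx (∈-lookup j)
  AllPairs-lookup (_ ∷ Rxs) {fsuc i} {fsuc j} (s≤s i<j) = AllPairs-lookup Rxs i<j

  Unique-lookup-injective : ∀ {xs} → Unique xs → ∀ {i j} → lookup xs i ≡ lookup xs j → i ≡ j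
  Unique-lookup-injective u {i} {j} eq with <-cmp (toℕ i) (toℕ j)
  ... | tri< i<j _ _ = ⊥-elim (AllPairs-lookup u i<j eq)
  ... | tri≈ _ i≡j _ = toℕ-injective i≡j
  ... | tri> _ _ i>j = ⊥-elim (AllPairs-lookup u i>j (sym eq))

  ∈⇒lookup : ∀ {x : A} {xs} → x ∈ xs → ∃ λ i → lookup xs i ≡ x
  ∈⇒lookup x∈xs = index x∈xs , sym (lookup-index x∈xs)

module _ {n : ℕ} where

  Sorted : List (Fin n) → Set
  Sorted = AllPairs (λ a b → toℕ a < toℕ b)

  Sorted⇒Unique : ∀ {xs} → Sorted xs → Unique xs
  Sorted⇒Unique = AllPairs.map (λ a<b a≡b → <-irrefl (cong toℕ a≡b) a<b)

  filter-sorted : {P : Pred (Fin n) 0ℓ} (P? : Decidable P) → Sorted (filter P? (allFin n))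
  filter-sorted P? = AllPairs.filter⁺ P? (AllPairs.tabulate⁺-< (λ i<j → i<j))

  module _ {xs : List (Fin n)} (sorted : Sorted xs) where

    lookup-mono-< : ∀ {i j} → toℕ i < toℕ j → toℕ (lookup xs i) < toℕ (lookup xs j)
    lookup-mono-< = AllPairs-lookup sorted

    lookup-mono-≤ : ∀ {i j} → toℕ i ≤ toℕ j → toℕ (lookup xs i) ≤ toℕ (lookup xs j)
    lookup-mono-≤ {i} {j} i≤j with <-cmp (toℕ i) (toℕ j)
    ... | tri< i<j _ _ = <⇒≤ (lookup-mono-< i<j)
    ... | tri≈ _ i≡j _ = ≤-reflexive (cong (λ z → toℕ (lookup xs z)) (toℕ-injective i≡j))
    ... | tri> _ _ i>j = ⊥-elim (<⇒≱ i>j i≤j)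

    lookup-cancel-< : ∀ {i j} → toℕ (lookup xs i) < toℕ (lookup xs j) → toℕ i < toℕ j
    lookup-cancel-< {i} {j} lt = ≰⇒> (λ j≤i → <⇒≱ lt (lookup-mono-≤ j≤i))

record Enumeration {n : ℕ} (P : Pred (Fin n) 0ℓ) (xs : List (Fin n)) : Set where
  field
    sorted   : Sorted xs
    sound    : ∀ {x} → x ∈ xs → P x
    complete : ∀ {x} → P x → x ∈ xs

filter-enumeration : ∀ {n} {P : Pred (Fin n) 0ℓ} (P? : Decidable P) → Enumeration P (filter P? (allFin n))
filter-enumeration P? = record
  { sorted   = filter-sorted P?
  ; sound    = λ x∈ → proj₂ (∈-filter⁻ P? {xs = allFin _} x∈)
  ; complete = λ px → ∈-filter⁺ P? (∈-allFin _) px }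

TwoIn⇒2≤length : ∀ {n} {P : Pred (Fin (suc n)) 0ℓ} {xs} → Enumeration P xs → TwoIn P → 2 ≤ length xs
TwoIn⇒2≤length enum (twoIn u v u≢v pu pv) = both-in (complete pu) (complete pv)
  where
  open Enumeration enum
  both-in : ∀ {ys : List (Fin _)} → u ∈ ys → v ∈ ys → 2 ≤ length ys
  both-in {_ ∷ []}    (here refl) (here refl) = ⊥-elim (u≢v refl)
  both-in {_ ∷ _ ∷ _} _           _           = s≤s (s≤s z≤n)

module _ {k : ℕ} {P : Pred (Fin (suc k)) 0ℓ} where

  lookup-cs-NextIn : ∀ {xs} → Enumeration P xs → 2 ≤ length xs → (j : Fin (length xs)) → NextIn P (lookup xs j) (lookup xs (cs j))
  lookup-cs-NextIn {y ∷ ys} enum (s≤s 1≤len) j with <-cmp (toℕ j) (length ys)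
  ... | tri> _ _ j>len = ⊥-elim (<⇒≱ j>len (toℕ≤pred[n] j))
  ... | tri< j<len _ _ = nextIn (sound (∈-lookup j)) (sound (∈-lookup (cs j))) distinct no-P-between
    where
    open Enumeration enum
    j<cj : toℕ j < toℕ (cs j)
    j<cj = subst (toℕ j <_) (sym (toℕ-cs-< j j<len)) (n<1+n _)
    distinct : lookup (y ∷ ys) j ≢ lookup (y ∷ ys) (cs j)
    distinct eq = <-irrefl (cong toℕ eq) (lookup-mono-< sorted j<cj)
    no-P-between : ∀ c → Between (lookup (y ∷ ys) j) (lookup (y ∷ ys) (cs j)) c → ¬ P c
    no-P-between c c∈ pc with ∈⇒lookup (complete pc)
    ... | i , refl with Between-toℕ-< (lookup-mono-< sorted j<cj) c∈
    ...   | j<i , i<cj = <⇒≱ (lookup-cancel-< sorted i<cj) (subst (_≤ toℕ i) (sym (toℕ-cs-< j j<len)) (lookup-cancel-< sorted j<i))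
  ... | tri≈ _ j≡len _ = nextIn (sound (∈-lookup j)) (sound (∈-lookup (cs j))) distinct no-P-between
    where
    open Enumeration enum
    cj≡0 : toℕ (cs j) ≡ 0
    cj≡0 = toℕ-cs-last j j≡len
    distinct : lookup (y ∷ ys) j ≢ lookup (y ∷ ys) (cs j)
    distinct eq = <⇒≢ (≤-trans (s≤s z≤n) 1≤len)
      (sym (trans (sym j≡len) (trans (cong toℕ (Unique-lookup-injective (Sorted⇒Unique sorted) eq)) cj≡0)))
    cj≤j : toℕ (lookup (y ∷ ys) (cs j)) ≤ toℕ (lookup (y ∷ ys) j)
    cj≤j = lookup-mono-≤ sorted (subst (_≤ toℕ j) (sym cj≡0) z≤n)
    no-P-between : ∀ c → Between (lookup (y ∷ ys) j) (lookup (y ∷ ys) (cs j)) c → ¬ P c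
    no-P-between c c∈ pc with ∈⇒lookup (complete pc)
    ... | i , refl with Between-toℕ-≥ cj≤j c∈
    ...   | inj₁ j<i  = <⇒≱ (lookup-cancel-< sorted j<i) (subst (toℕ i ≤_) (sym j≡len) (toℕ≤pred[n] i))
    ...   | inj₂ i<cj = <⇒≱ (lookup-cancel-< sorted i<cj) (subst (_≤ toℕ i) (sym cj≡0) z≤n)

  NextIn-predecessor : ∀ {xs} → Enumeration P xs → 2 ≤ length xs → ∀ {x} → P x → ∃ λ a → NextIn P a x
  NextIn-predecessor {y ∷ ys} enum 2≤len px with ∈⇒lookup (Enumeration.complete enum px)
  ... | i , refl = lookup (y ∷ ys) (csl i) ,
                   subst (λ z → NextIn P (lookup (y ∷ ys) (csl i)) (lookup (y ∷ ys) z)) (cs-csl i) (lookup-cs-NextIn enum 2≤len (csl i))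

  NextIn-injective : ∀ {xs} → Enumeration P xs → 2 ≤ length xs → ∀ {a a′ b} → NextIn P a b → NextIn P a′ b → a ≡ a′
  NextIn-injective {y ∷ ys} enum 2≤len {b = b} ab a′b
    with ∈⇒lookup (Enumeration.complete enum (from∈ ab)) | ∈⇒lookup (Enumeration.complete enum (from∈ a′b))
  ... | i , refl | i′ , refl =
    cong (lookup (y ∷ ys)) (cs-injective (Unique-lookup-injective (Sorted⇒Unique (Enumeration.sorted enum)) (trans (sym b≡i) b≡i′)))
    where
    b≡i : b ≡ lookup (y ∷ ys) (cs i)
    b≡i = NextIn-functional ab (lookup-cs-NextIn enum 2≤len i)
    b≡i′ : b ≡ lookup (y ∷ ys) (cs i′)
    b≡i′ = NextIn-functional a′b (lookup-cs-NextIn enum 2≤len i′)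

module _ {k : ℕ} {Q : Pred (Fin (suc k)) 0ℓ} (Q? : Decidable Q) (two : TwoIn Q) where

  private
    enum : Enumeration Q (filter Q? (allFin (suc k)))
    enum = filter-enumeration Q?

  predecessor : ∀ {x} → Q x → ∃ λ a → NextIn Q a x
  predecessor = NextIn-predecessor enum (TwoIn⇒2≤length enum two)

  predecessor-unique : ∀ {a a′ b} → NextIn Q a b → NextIn Q a′ b → a ≡ a′
  predecessor-unique = NextIn-injective enum (TwoIn⇒2≤length enum two)

-- Rotating a vector along a subset

module _ {k : ℕ} {Q : Pred (Fin (suc k)) 0ℓ} (Q? : Decidable Q) (h : Fin (suc k) → Fin (suc k)) where

  -- Opaque: it is only used through the three lemmas below, and letting Agda unfold it inside
  -- Ends3 goals makes them prohibitively expensive to compare.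
  opaque
    shiftOn : Fin (suc k) → Fin (suc k)
    shiftOn x with any? (λ a → nextIn? Q? a x)
    ... | yes (a , _) = h a
    ... | no _        = h x

    shiftOn-outside : ∀ {x} → ¬ Q x → shiftOn x ≡ h x
    shiftOn-outside {x} ¬qx with any? (λ a → nextIn? Q? a x)
    ... | yes (_ , ax) = ⊥-elim (¬qx (to∈ ax))
    ... | no _         = refl

    shiftOn-after : ∀ {a b} → (∀ {a′} → NextIn Q a′ b → a′ ≡ a) → NextIn Q a b → shiftOn b ≡ h a
    shiftOn-after {a} {b} unique ab with any? (λ a → nextIn? Q? a b)
    ... | yes (a′ , a′b) = cong h (unique a′b)
    ... | no ¬pred       = ⊥-elim (¬pred (a , ab))

  moved⇒∈ : ∀ {x} → shiftOn x ≢ h x → Q x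
  moved⇒∈ {x} moved with Q? x
  ... | yes qx  = qx
  ... | no ¬qx = ⊥-elim (moved (shiftOn-outside ¬qx))

  module _ (two : TwoIn Q) where

    shiftOn-next : ∀ {a b} → NextIn Q a b → shiftOn b ≡ h a
    shiftOn-next ab = shiftOn-after (λ a′b → predecessor-unique Q? two a′b ab) ab

    shiftOn-unique : (f : Fin (suc k) → Fin (suc k)) → (∀ {x} → ¬ Q x → f x ≡ h x) →
                     (∀ {a b} → NextIn Q a b → f b ≡ h a) → ∀ x → f x ≡ shiftOn x
    shiftOn-unique f f-outside f-next x with Q? x
    ... | no ¬qx = trans (f-outside ¬qx) (sym (shiftOn-outside ¬qx))
    ... | yes qx = let (a , ax) = predecessor Q? two qx in trans (f-next ax) (sym (shiftOn-next ax))

    module _ (h-inj : ∀ {x y} → h x ≡ h y → x ≡ y) where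

      shiftOn-moves : ∀ {x} → Q x → shiftOn x ≢ h x
      shiftOn-moves qx eq = let (a , ax) = predecessor Q? two qx in from≢to ax (h-inj (trans (sym (shiftOn-next ax)) eq))

      shiftOn-injective : ∀ {x y} → shiftOn x ≡ shiftOn y → x ≡ y
      shiftOn-injective {x} {y} eq with Q? x | Q? y
      ... | no ¬qx | no ¬qy = h-inj (trans (sym (shiftOn-outside ¬qx)) (trans eq (shiftOn-outside ¬qy)))
      ... | yes qx | no ¬qy = let (a , ax) = predecessor Q? two qx in
        ⊥-elim (¬qy (subst Q (h-inj (trans (sym (shiftOn-next ax)) (trans eq (shiftOn-outside ¬qy)))) (from∈ ax)))
      ... | no ¬qx | yes qy = let (a , ay) = predecessor Q? two qy in
        ⊥-elim (¬qx (subst Q (h-inj (trans (sym (shiftOn-next ay)) (trans (sym eq) (shiftOn-outside ¬qx)))) (from∈ ay)))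
      ... | yes qx | yes qy = let (a , ax) = predecessor Q? two qx ; (a′ , a′y) = predecessor Q? two qy in
        NextIn-functional ax (subst (λ z → NextIn Q z y) (h-inj (trans (sym (shiftOn-next a′y)) (trans (sym eq) (shiftOn-next ax)))) a′y)

    shiftOn-derangement : (∀ x → h x ≢ x) → Avoids h Q → ∀ x → shiftOn x ≢ x
    shiftOn-derangement h-moves avoids x eq with Q? x
    ... | no ¬qx = h-moves x (trans (sym (shiftOn-outside ¬qx)) eq)
    ... | yes qx = let (a , ax) = predecessor Q? two qx in avoids ax (sym (trans (sym (shiftOn-next ax)) eq))

module _ {k : ℕ} {Q Q′ : Pred (Fin (suc k)) 0ℓ} (Q? : Decidable Q) (Q′? : Decidable Q′) (h : Fin (suc k) → Fin (suc k)) where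

  shiftOn-cong : TwoIn Q → Q ⊆ Q′ → Q′ ⊆ Q → ∀ x → shiftOn Q? h x ≡ shiftOn Q′? h x
  shiftOn-cong two Q⊆Q′ Q′⊆Q = shiftOn-unique Q′? h (TwoIn-⊆ Q⊆Q′ two) (shiftOn Q? h)
    (λ ¬q′x → shiftOn-outside Q? h (λ qx → ¬q′x (Q⊆Q′ qx)))
    (λ ab → shiftOn-next Q? h two (NextIn-map Q′⊆Q Q⊆Q′ ab))

  shiftOn-reflects-⊆ : TwoIn Q → (∀ {x y} → h x ≡ h y → x ≡ y) → (∀ x → shiftOn Q? h x ≡ shiftOn Q′? h x) → Q ⊆ Q′
  shiftOn-reflects-⊆ two h-inj same {x} qx = moved⇒∈ Q′? h (λ eq → shiftOn-moves Q? h two h-inj qx (trans (same x) eq))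

-- The game

module _ {A : Set} {n m : ℕ} where

  writeAll : Vector A n → (Fin m → Fin n) → (Fin m → A) → List (Fin m) → Vector A n
  writeAll γ f v = foldr (λ j g → updateAt g (f j) (const (v j))) γ

  writeAll-hit : (γ : Vector A n) {f : Fin m → Fin n} (v : Fin m → A) → (∀ {a b} → f a ≡ f b → a ≡ b) →
                 ∀ {j js} → j ∈ js → writeAll γ f v js (f j) ≡ v j
  writeAll-hit γ {f} v f-inj {j} {j′ ∷ js} j∈ with j ≟ j′
  ... | yes refl = updateAt-updates (f j) (writeAll γ f v js)
  ... | no j≢j′  = trans (updateAt-minimal (f j) (f j′) (writeAll γ f v js) (λ eq → j≢j′ (f-inj eq)))
                         (writeAll-hit γ v f-inj (tail j∈))
    where
    tail : j ∈ j′ ∷ js → j ∈ js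
    tail (here j≡j′) = ⊥-elim (j≢j′ j≡j′)
    tail (there j∈js) = j∈js

  writeAll-miss : (γ : Vector A n) {f : Fin m → Fin n} (v : Fin m → A) (js : List (Fin m)) →
                  ∀ {q} → (∀ j → f j ≢ q) → writeAll γ f v js q ≡ γ q
  writeAll-miss γ v []        _    = refl
  writeAll-miss γ v (j ∷ js) {q} miss = trans (updateAt-minimal q _ (writeAll γ _ v js) (λ eq → miss j (sym eq))) (writeAll-miss γ v js miss)

  writeAll-cong : {γ γ′ : Vector A n} {f f′ : Fin m → Fin n} {v v′ : Fin m → A} →
                  (∀ x → γ x ≡ γ′ x) → (∀ j → f j ≡ f′ j) → (∀ j → v j ≡ v′ j) →
                  ∀ js q → writeAll γ f v js q ≡ writeAll γ′ f′ v′ js q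
  writeAll-cong γ≗ f≗ v≗ []       q = γ≗ q
  writeAll-cong {f = f} {f′} γ≗ f≗ v≗ (j ∷ js) q with q ≟ f j
  ... | yes refl rewrite f≗ j = trans (updateAt-updates (f′ j) _) (trans (v≗ j) (sym (updateAt-updates (f′ j) _)))
  ... | no q≢fj = trans (updateAt-minimal q (f j) _ q≢fj)
                    (trans (writeAll-cong γ≗ f≗ v≗ js q)
                           (sym (updateAt-minimal q (f′ j) _ (λ q≡f′j → q≢fj (trans q≡f′j (sym (f≗ j)))))))

module _ {n : ℕ} where

  private
    V : Set
    V = Vector (Fin n) n

  -- next S γ π is definitionally nextWith S γ (wrong γ π).
  nextWith : Strategy → V → List (Fin n) → V
  nextWith S γ I = writeAll γ (λ j → lookup I (S (length I) j)) (λ j → γ (lookup I j)) (allFin (length I))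

  wrong-enumeration : (γ π : V) → Enumeration (λ i → γ i ≢ π i) (wrong γ π)
  wrong-enumeration γ π = filter-enumeration (λ i → ¬? (γ i ≟ π i))

  next-moves : (S : Strategy) (γ π : V) → let m = length (wrong γ π) in (∀ {a b} → S m a ≡ S m b → a ≡ b) →
               ∀ j → next S γ π (lookup (wrong γ π) (S m j)) ≡ γ (lookup (wrong γ π) j)
  next-moves S γ π S-inj j =
    writeAll-hit γ _ (λ eq → S-inj (Unique-lookup-injective (Sorted⇒Unique (Enumeration.sorted (wrong-enumeration γ π))) eq)) (∈-allFin j)

  next-keeps : (S : Strategy) (γ π : V) → ∀ {q} → γ q ≡ π q → next S γ π q ≡ γ q
  next-keeps S γ π {q} γq≡πq = writeAll-miss γ (λ j → γ (lookup (wrong γ π) j)) (allFin _)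
    (λ j eq → Enumeration.sound (wrong-enumeration γ π) (subst (_∈ wrong γ π) eq (∈-lookup _)) γq≡πq)

  next-cong : (S S′ : Strategy) {γ γ′ π π′ : V} → (∀ x → γ x ≡ γ′ x) → (∀ x → π x ≡ π′ x) →
              (∀ j → S (length (wrong γ π)) j ≡ S′ (length (wrong γ π)) j) → ∀ q → next S γ π q ≡ next S′ γ′ π′ q
  next-cong S S′ {γ} {γ′} {π} {π′} γ≗ π≗ S≗ q =
    trans (writeAll-cong γ≗ (λ j → cong (lookup (wrong γ π)) (S≗ j)) (λ j → γ≗ _) (allFin _) q)
          (cong (λ I → nextWith S′ γ′ I q) same-wrong)
    where
    same-wrong : wrong γ π ≡ wrong γ′ π′
    same-wrong = filter-≐ (λ i → ¬? (γ i ≟ π i)) (λ i → ¬? (γ′ i ≟ π′ i))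
      ((λ {x} ne eq → ne (trans (γ≗ x) (trans eq (sym (π≗ x))))) , (λ {x} ne eq → ne (trans (sym (γ≗ x)) (trans eq (π≗ x)))))
      (allFin n)

  wrong-all : (γ π : V) → (∀ x → γ x ≢ π x) → wrong γ π ≡ allFin n
  wrong-all γ π all-wrong = filter-all (λ i → ¬? (γ i ≟ π i)) (All.tabulate (λ {x} _ → all-wrong x))

  length-wrong<n : (γ π : V) → ∀ {q} → γ q ≡ π q → length (wrong γ π) ≢ n
  length-wrong<n γ π {q} γq≡πq len≡n = <-irrefl len≡n (subst (length (wrong γ π) <_) (length-tabulate id)
    (filter-notAll (λ i → ¬? (γ i ≟ π i)) (allFin n) (Any.map (λ { refl ne → ne γq≡πq }) (∈-allFin q))))

  module _ (τ : Fin n → Fin n) where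

    indStrat-top : ∀ x → indStrat n τ n x ≡ τ x
    indStrat-top x with n ≟ℕ n
    ... | yes refl = refl
    ... | no n≢n   = ⊥-elim (n≢n refl)

    indStrat-below : ∀ {m} → m ≢ n → ∀ x → indStrat n τ m x ≡ cs x
    indStrat-below {m} m≢n x with m ≟ℕ n
    ... | yes m≡n = ⊥-elim (m≢n m≡n)
    ... | no _    = refl

    -- Matching on m ≟ℕ n itself would also rewrite the test inside indStrat in the type of eq.
    indStrat-injective : (∀ {a b} → τ a ≡ τ b → a ≡ b) → ∀ m {a b} → indStrat n τ m a ≡ indStrat n τ m b → a ≡ b
    indStrat-injective τ-inj m {a} {b} eq with toSum (m ≟ℕ n)
    ... | inj₁ refl = τ-inj (trans (sym (indStrat-top a)) (trans eq (indStrat-top b)))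
    indStrat-injective τ-inj (suc m) {a} {b} eq | inj₂ m≢n =
      cs-injective (trans (sym (indStrat-below m≢n a)) (trans eq (indStrat-below m≢n b)))

    next-partial : (∀ {a b} → τ a ≡ τ b → a ≡ b) → (γ π : V) → length (wrong γ π) ≢ n →
                   ∀ j → next (indStrat n τ) γ π (lookup (wrong γ π) (cs j)) ≡ γ (lookup (wrong γ π) j)
    next-partial τ-inj γ π len≢n j =
      trans (cong (λ z → next (indStrat n τ) γ π (lookup (wrong γ π) z)) (sym (indStrat-below len≢n j)))
            (next-moves (indStrat n τ) γ π (indStrat-injective τ-inj _) j)

    next-full : (∀ {a b} → τ a ≡ τ b → a ≡ b) → (γ π : V) → (∀ x → γ x ≢ π x) →
                ∀ j → next (indStrat n τ) γ π (τ j) ≡ γ j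
    next-full τ-inj γ π all-wrong j = begin
      next S γ π (τ j)                           ≡⟨ cong (next S γ π) (lookup-cast (wrong-all γ π all-wrong) {len≡n} (τ j)) ⟨
      next S γ π (lookup I (ι (τ j)))            ≡⟨ cong (λ z → next S γ π (lookup I z)) (indStrat-cast len≡n j) ⟨
      next S γ π (lookup I (S (length I) (ι j))) ≡⟨ next-moves S γ π (indStrat-injective τ-inj _) (ι j) ⟩
      γ (lookup I (ι j))                         ≡⟨ cong γ (lookup-cast (wrong-all γ π all-wrong) {len≡n} j) ⟩
      γ j                                        ∎
      where
      open ≡-Reasoning
      S : Strategy
      S = indStrat n τ
      I : List (Fin n)
      I = wrong γ π
      len≡n : length I ≡ n
      len≡n = trans (cong length (wrong-all γ π all-wrong)) (length-tabulate id)
      ι : Fin n → Fin (length I)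
      ι = cast (sym len≡n)
      lookup-cast : ∀ {J} → J ≡ allFin n → ∀ {e : length J ≡ n} j → lookup J (cast (sym e) j) ≡ j
      lookup-cast refl j = lookup-tabulate id j
      indStrat-cast : ∀ {m} (e : m ≡ n) j → indStrat n τ m (cast (sym e) j) ≡ cast (sym e) (τ j)
      indStrat-cast refl j = trans (indStrat-top (cast refl j)) (trans (cong τ (cast-is-id refl j)) (sym (cast-is-id refl (τ j))))

  guess-cong : (S : Strategy) {π π′ : V} → (∀ x → π x ≡ π′ x) → ∀ r x → guess S π r x ≡ guess S π′ r x
  guess-cong S π≗π′ zero          x = refl
  guess-cong S π≗π′ (suc zero)    x = refl
  guess-cong S π≗π′ (suc (suc r)) x = next-cong S S (guess-cong S π≗π′ (suc r)) π≗π′ (λ _ → refl) x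

  guess-keeps-fixed : (S : Strategy) (π : V) → ∀ {q} → π q ≡ q → ∀ r → guess S π r q ≡ q
  guess-keeps-fixed S π πq≡q zero          = refl
  guess-keeps-fixed S π πq≡q (suc zero)    = refl
  guess-keeps-fixed S π πq≡q (suc (suc r)) =
    trans (next-keeps S (guess S π (suc r)) π (trans (guess-keeps-fixed S π πq≡q (suc r)) (sym πq≡q)))
          (guess-keeps-fixed S π πq≡q (suc r))

  guess-indStrat-fixed : (τ τ′ : Fin n → Fin n) (π : V) → ∀ {q} → π q ≡ q →
                         ∀ r x → guess (indStrat n τ) π r x ≡ guess (indStrat n τ′) π r x
  guess-indStrat-fixed τ τ′ π πq≡q zero          x = refl
  guess-indStrat-fixed τ τ′ π πq≡q (suc zero)    x = refl
  guess-indStrat-fixed τ τ′ π πq≡q (suc (suc r)) x =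
    next-cong (indStrat n τ) (indStrat n τ′) (guess-indStrat-fixed τ τ′ π πq≡q (suc r)) (λ _ → refl)
      (λ j → trans (indStrat-below τ len≢n j) (sym (indStrat-below τ′ len≢n j))) x
    where
    γ : V
    γ = guess (indStrat n τ) π (suc r)
    len≢n : length (wrong γ π) ≢ n
    len≢n = length-wrong<n γ π (trans (guess-keeps-fixed (indStrat n τ) π πq≡q (suc r)) (sym πq≡q))

  Ends3-transport : {S S′ : Strategy} {π π′ : V} → (∀ r x → guess S π r x ≡ guess S′ π′ r x) → (∀ x → π x ≡ π′ x) →
                    Ends3 S π → Ends3 S′ π′
  Ends3-transport same π≗π′ (¬solved₁ , ¬solved₂ , solved₃) =
    (λ solved → ¬solved₁ (λ x → trans (same 1 x) (trans (solved x) (sym (π≗π′ x))))) ,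
    (λ solved → ¬solved₂ (λ x → trans (same 2 x) (trans (solved x) (sym (π≗π′ x))))) ,
    (λ x → trans (sym (same 3 x)) (trans (solved₃ x) (π≗π′ x)))

Derangement : ∀ {n} → Vector (Fin n) n → Set
Derangement π = ∀ x → π x ≢ x

-- A record rather than a product, so that Agda compares its indices instead of unfolding Ends3.
record Ends3Perm {n : ℕ} (S : Strategy) (π : Vector (Fin n) n) : Set where
  constructor ends3Perm
  field
    isPerm : IsPerm π
    ends3  : Ends3 S π

module ThreeRounds {k : ℕ} (τ h : Fin (suc k) → Fin (suc k)) (τ∘h : ∀ y → τ (h y) ≡ y) (h∘τ : ∀ x → h (τ x) ≡ x) where

  private
    V : Set
    V = Vector (Fin (suc k)) (suc k)

  τ-injective : ∀ {x y} → τ x ≡ τ y → x ≡ y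
  τ-injective {x} {y} eq = trans (sym (h∘τ x)) (trans (cong h eq) (h∘τ y))

  h-injective : ∀ {x y} → h x ≡ h y → x ≡ y
  h-injective {x} {y} eq = trans (sym (τ∘h x)) (trans (cong τ eq) (τ∘h y))

  guess₂ : {π : V} → Derangement π → ∀ x → guess (indStrat (suc k) τ) π 2 x ≡ h x
  guess₂ {π} der x = trans (cong (guess (indStrat (suc k) τ) π 2) (sym (τ∘h x)))
                          (next-full τ τ-injective (λ i → i) π (λ i eq → der i (sym eq)) (h x))

  -- For a derangement π these are the positions still wrong after the second guess (guess₂).
  Wrong₂ : V → Pred (Fin (suc k)) 0ℓ
  Wrong₂ π x = h x ≢ π x

  wrong₂? : (π : V) → Decidable (Wrong₂ π)
  wrong₂? π x = ¬? (h x ≟ π x)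

  guess₃-full : {π : V} → Derangement π → (∀ x → Wrong₂ π x) → ∀ x → guess (indStrat (suc k) τ) π 3 x ≡ h (h x)
  guess₃-full {π} der all-wrong x = begin
    guess S π 3 x          ≡⟨ cong (guess S π 3) (τ∘h x) ⟨
    guess S π 3 (τ (h x))  ≡⟨ next-full τ τ-injective (guess S π 2) π (λ y eq → all-wrong y (trans (sym (guess₂ der y)) eq)) (h x) ⟩
    guess S π 2 (h x)      ≡⟨ guess₂ der (h x) ⟩
    h (h x)                ∎
    where
    open ≡-Reasoning
    S : Strategy
    S = indStrat (suc k) τ

  wrong₂-enumeration : {π : V} → Derangement π → Enumeration (Wrong₂ π) (wrong (guess (indStrat (suc k) τ) π 2) π)
  wrong₂-enumeration {π} der = record
    { sorted   = sorted
    ; sound    = λ x∈ eq → sound x∈ (trans (guess₂ der _) eq)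
    ; complete = λ wx → complete (λ eq → wx (trans (sym (guess₂ der _)) eq)) }
    where open Enumeration (wrong-enumeration (guess (indStrat (suc k) τ) π 2) π)

  guess₃-partial : {π : V} → Derangement π → (∃ λ x → h x ≡ π x) →
                   ∀ {a b} → NextIn (Wrong₂ π) a b → guess (indStrat (suc k) τ) π 3 b ≡ h a
  guess₃-partial {π} der (x , hx≡πx) {a} {b} ab with ∈⇒lookup (Enumeration.complete (wrong₂-enumeration der) (from∈ ab))
  ... | j , refl = begin
    guess S π 3 b                 ≡⟨ cong (guess S π 3) (NextIn-functional ab (lookup-cs-NextIn enum 2≤len j)) ⟩
    guess S π 3 (lookup L (cs j)) ≡⟨ next-partial τ τ-injective (guess S π 2) π len≢n j ⟩
    guess S π 2 (lookup L j)      ≡⟨ guess₂ der _ ⟩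
    h (lookup L j)                ∎
    where
    open ≡-Reasoning
    S : Strategy
    S = indStrat (suc k) τ
    L : List (Fin (suc k))
    L = wrong (guess S π 2) π
    enum : Enumeration (Wrong₂ π) L
    enum = wrong₂-enumeration der
    2≤len : 2 ≤ length L
    2≤len = TwoIn⇒2≤length enum (NextIn⇒TwoIn ab)
    len≢n : length L ≢ suc k
    len≢n = length-wrong<n (guess S π 2) π (trans (guess₂ der x) hx≡πx)

  ¬solved₁ : {π : V} → Derangement π → ¬ Solved (guess (indStrat (suc k) τ) π 1) π
  ¬solved₁ der solved = der fzero (sym (solved fzero))

  Ends3-full⇒ : {π : V} → Derangement π → Ends3 (indStrat (suc k) τ) π → (∀ x → Wrong₂ π x) → ∀ x → π x ≡ h (h x)
  Ends3-full⇒ der (_ , _ , solved₃) all-wrong x = trans (sym (solved₃ x)) (guess₃-full der all-wrong x)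

  Ends3-partial⇒ : {π : V} → Derangement π → Ends3 (indStrat (suc k) τ) π → (∃ λ x → h x ≡ π x) →
                   TwoIn (Wrong₂ π) × (∀ {a b} → NextIn (Wrong₂ π) a b → π b ≡ h a)
  Ends3-partial⇒ {π} der (_ , ¬solved₂ , solved₃) right = two , λ ab → trans (sym (solved₃ _)) (guess₃-partial der right ab)
    where
    S : Strategy
    S = indStrat (suc k) τ
    L : List (Fin (suc k))
    L = wrong (guess S π 2) π
    enum : Enumeration (Wrong₂ π) L
    enum = wrong₂-enumeration der
    some-wrong : ∃ λ x → ¬ (guess S π 2 x ≡ π x)
    some-wrong = ¬∀⟶∃¬ (suc k) _ (λ i → guess S π 2 i ≟ π i) ¬solved₂
    x₀ : Fin (suc k)
    x₀ = proj₁ some-wrong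
    wrong-x₀ : Wrong₂ π x₀
    wrong-x₀ eq = proj₂ some-wrong (trans (guess₂ der x₀) eq)
    x₀-in-L : ∃ λ j → lookup L j ≡ x₀
    x₀-in-L = ∈⇒lookup (Enumeration.complete enum wrong-x₀)
    j : Fin (length L)
    j = proj₁ x₀-in-L
    -- A single wrong position would be left unchanged by the third guess.
    y₀ : Fin (suc k)
    y₀ = lookup L (cs j)
    y₀≢x₀ : y₀ ≢ x₀
    y₀≢x₀ y₀≡x₀ = wrong-x₀ (begin
      h x₀                      ≡⟨ guess₂ der x₀ ⟨
      guess S π 2 x₀            ≡⟨ cong (guess S π 2) (proj₂ x₀-in-L) ⟨
      guess S π 2 (lookup L j)  ≡⟨ next-partial τ τ-injective (guess S π 2) π len≢n j ⟨
      guess S π 3 y₀            ≡⟨ solved₃ y₀ ⟩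
      π y₀                      ≡⟨ cong π y₀≡x₀ ⟩
      π x₀                      ∎)
      where
      open ≡-Reasoning
      len≢n : length L ≢ suc k
      len≢n = length-wrong<n (guess S π 2) π (trans (guess₂ der _) (proj₂ right))
    two : TwoIn (Wrong₂ π)
    two = twoIn x₀ y₀ (≢-sym y₀≢x₀) wrong-x₀ (Enumeration.sound enum (∈-lookup (cs j)))

  ⇒Ends3-full : {π : V} → Derangement π → (∀ x → h x ≢ x) → (∀ x → π x ≡ h (h x)) → Ends3 (indStrat (suc k) τ) π
  ⇒Ends3-full {π} der h-moves π≗hh = ¬solved₁ der , ¬solved₂ , solved₃
    where
    all-wrong : ∀ x → Wrong₂ π x
    all-wrong x hx≡πx = h-moves x (sym (h-injective (trans hx≡πx (π≗hh x))))
    ¬solved₂ : ¬ Solved (guess (indStrat (suc k) τ) π 2) π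
    ¬solved₂ solved = all-wrong fzero (trans (sym (guess₂ der fzero)) (solved fzero))
    solved₃ : Solved (guess (indStrat (suc k) τ) π 3) π
    solved₃ x = trans (guess₃-full der all-wrong x) (sym (π≗hh x))

  ⇒Ends3-partial : {π : V} → Derangement π → TwoIn (Wrong₂ π) → (∃ λ x → h x ≡ π x) →
                   (∀ {a b} → NextIn (Wrong₂ π) a b → π b ≡ h a) → Ends3 (indStrat (suc k) τ) π
  ⇒Ends3-partial {π} der two right shape = ¬solved₁ der , ¬solved₂ , solved₃
    where
    ¬solved₂ : ¬ Solved (guess (indStrat (suc k) τ) π 2) π
    ¬solved₂ solved = TwoIn.fst∈ two (trans (sym (guess₂ der _)) (solved _))
    solved₃ : Solved (guess (indStrat (suc k) τ) π 3) π
    solved₃ x with h x ≟ π x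
    ... | yes hx≡πx = let right-x = trans (guess₂ der x) hx≡πx in
      trans (next-keeps (indStrat (suc k) τ) (guess (indStrat (suc k) τ) π 2) π right-x) right-x
    ... | no wrong-x = let (a , ax) = predecessor (wrong₂? π) two wrong-x in
      trans (guess₃-partial der right ax) (sym (shape ax))

  module _ (h-moves : ∀ x → h x ≢ x) where

    hh-Ends3 : (∀ x → h (h x) ≢ x) → Ends3Perm (indStrat (suc k) τ) (λ x → h (h x)) × Derangement (λ x → h (h x))
    hh-Ends3 hh-moves = ends3Perm (λ _ _ eq → h-injective (h-injective eq)) (⇒Ends3-full hh-moves h-moves (λ _ → refl)) , hh-moves

    shiftOn-Ends3 : {E : Pred (Fin (suc k)) 0ℓ} (E? : Decidable E) → TwoIn E → (∃ λ z → ¬ E z) → Avoids h E →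
                    Ends3Perm (indStrat (suc k) τ) (shiftOn E? h) × Derangement (shiftOn E? h)
    shiftOn-Ends3 {E} E? two (z , ¬ez) avoids =
      ends3Perm (λ _ _ → shiftOn-injective E? h two h-injective) (⇒Ends3-partial der (TwoIn-⊆ E⊆wrong two) right shape) , der
      where
      der : Derangement (shiftOn E? h)
      der = shiftOn-derangement E? h two h-moves avoids
      E⊆wrong : ∀ {x} → E x → Wrong₂ (shiftOn E? h) x
      E⊆wrong ex eq = shiftOn-moves E? h two h-injective ex (sym eq)
      wrong⊆E : ∀ {x} → Wrong₂ (shiftOn E? h) x → E x
      wrong⊆E wx = moved⇒∈ E? h (≢-sym wx)
      right : ∃ λ x → h x ≡ shiftOn E? h x
      right = z , sym (shiftOn-outside E? h ¬ez)
      shape : ∀ {a b} → NextIn (Wrong₂ (shiftOn E? h)) a b → shiftOn E? h b ≡ h a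
      shape ab = shiftOn-next E? h two (NextIn-map wrong⊆E E⊆wrong ab)

-- Counting

module _ {A : Set} {L : List A} (unique : Unique L) (complete : ∀ a → a ∈ L)
         {p q : Pred A 0ℓ} (p? : Decidable p) (q? : Decidable q) (f : A → A)
         (maps : ∀ {a} → p a → q (f a)) (injective : ∀ {a b} → p a → p b → f a ≡ f b → a ≡ b)
         (w : A) (qw : q w) (misses : ∀ {a} → p a → f a ≢ w) where

  private
    P : List A
    P = filter p? L
    p-lookup : ∀ i → p (lookup P i)
    p-lookup i = proj₂ (∈-filter⁻ p? {xs = L} (∈-lookup i))
    extended : Fin (suc (length P)) → A
    extended fzero    = w
    extended (fsuc i) = f (lookup P i)
    q-extended : ∀ i → q (extended i)
    q-extended fzero    = qw
    q-extended (fsuc i) = maps (p-lookup i)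
    extended-injective : ∀ {i j} → extended i ≡ extended j → i ≡ j
    extended-injective {fzero}  {fzero}  _  = refl
    extended-injective {fzero}  {fsuc j} eq = ⊥-elim (misses (p-lookup j) (sym eq))
    extended-injective {fsuc i} {fzero}  eq = ⊥-elim (misses (p-lookup i) eq)
    extended-injective {fsuc i} {fsuc j} eq =
      cong fsuc (Unique-lookup-injective (Unique.filter⁺ p? unique) (injective (p-lookup i) (p-lookup j) eq))
    position : Fin (suc (length P)) → Fin (length (filter q? L))
    position i = index (∈-filter⁺ q? (complete (extended i)) (q-extended i))

  length-filter-< : length (filter p? L) < length (filter q? L)
  length-filter-< = injective⇒≤ λ {i} {j} eq → extended-injective (begin
    extended i                          ≡⟨ lookup-index (∈-filter⁺ q? (complete (extended i)) (q-extended i)) ⟩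
    lookup (filter q? L) (position i)   ≡⟨ cong (lookup (filter q? L)) eq ⟩
    lookup (filter q? L) (position j)   ≡⟨ lookup-index (∈-filter⁺ q? (complete (extended j)) (q-extended j)) ⟨
    extended j                          ∎)
    where open ≡-Reasoning

allVecs-complete : ∀ n m (v : Vec (Fin n) m) → v ∈ allVecs n m
allVecs-complete n zero    []      = Any.here refl
allVecs-complete n (suc m) (x ∷ v) =
  ∈-concatMap⁺ (λ i → map (i ∷_) (allVecs n m)) (Any.map (λ { refl → ∈-map⁺ (x ∷_) (allVecs-complete n m v) }) (∈-allFin x))

allVecs-unique : ∀ n m → Unique (allVecs n m)
allVecs-unique n zero    = All.[] AllPairs.∷ AllPairs.[]
allVecs-unique n (suc m) = Unique.concat⁺ (All.map⁺ (All.tabulate λ _ → rows-unique))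
                                          (AllPairs.map⁺ (AllPairs.map rows-disjoint (Unique.allFin⁺ n)))
  where
  rows-unique : ∀ {i} → Unique (map (i ∷_) (allVecs n m))
  rows-unique = Unique.map⁺ (λ eq → proj₂ (∷-injective eq)) (allVecs-unique n m)
  rows-disjoint : ∀ {i j} → i ≢ j → Disjoint (map (i ∷_) (allVecs n m)) (map (j ∷_) (allVecs n m))
  rows-disjoint i≢j (v∈i , v∈j) with ∈-map⁻ (_ ∷_) v∈i | ∈-map⁻ (_ ∷_) v∈j
  ... | _ , _ , refl | _ , _ , eq = i≢j (proj₁ (∷-injective eq))

Ends3Perm-cong : ∀ {n} (S : Strategy) {π π′ : Vector (Fin n) n} → (∀ x → π x ≡ π′ x) → Ends3Perm S π → Ends3Perm S π′
Ends3Perm-cong S π≗π′ (ends3Perm perm ends) =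
  ends3Perm (λ i j eq → perm i j (trans (π≗π′ i) (trans eq (sym (π≗π′ j))))) (Ends3-transport (guess-cong S π≗π′) π≗π′ ends)

coeff3-< : ∀ n (S S′ : Strategy) (f : Vector (Fin n) n → Vector (Fin n) n) →
           (∀ {π} → Ends3Perm S π → Ends3Perm S′ (f π)) →
           (∀ {π π′} → Ends3Perm S π → Ends3Perm S π′ → (∀ x → f π x ≡ f π′ x) → ∀ x → π x ≡ π′ x) →
           (w : Vector (Fin n) n) → Ends3Perm S′ w → (∀ {π} → Ends3Perm S π → ¬ (∀ x → f π x ≡ w x)) →
           coeff3 n S < coeff3 n S′
coeff3-< n S S′ f maps injective w w-ends misses =
  length-filter-< (allVecs-unique n n) (allVecs-complete n n)
    (λ v → isPerm? (vlookup v) ×-dec ends3? S (vlookup v)) (λ v → isPerm? (vlookup v) ×-dec ends3? S′ (vlookup v))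
    f⃗ (λ e → as-pair (Ends3Perm-cong S′ (λ x → sym (lookup∘tabulate _ x)) (maps (as-record e))))
    (λ ea eb eq → vec-ext (injective (as-record ea) (as-record eb) (tabulate-≡⇒≗ eq)))
    (tabulate w) (as-pair (Ends3Perm-cong S′ (λ x → sym (lookup∘tabulate w x)) w-ends))
    (λ e eq → misses (as-record e) (tabulate-≡⇒≗ eq))
  where
  as-record : ∀ {T π} → IsPerm π × Ends3 T π → Ends3Perm T π
  as-record (perm , ends) = ends3Perm perm ends
  as-pair : ∀ {T π} → Ends3Perm T π → IsPerm π × Ends3 T π
  as-pair (ends3Perm perm ends) = perm , ends
  f⃗ : Vec (Fin n) n → Vec (Fin n) n
  f⃗ v = tabulate (f (vlookup v))
  tabulate-≡⇒≗ : ∀ {g g′ : Vector (Fin n) n} → tabulate g ≡ tabulate g′ → ∀ x → g x ≡ g′ x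
  tabulate-≡⇒≗ {g} {g′} eq x = trans (sym (lookup∘tabulate g x)) (trans (cong (λ v → vlookup v x) eq) (lookup∘tabulate g′ x))
  vec-ext : ∀ {a b : Vec (Fin n) n} → (∀ x → vlookup a x ≡ vlookup b x) → a ≡ b
  vec-ext {a} {b} a≗b = trans (sym (tabulate∘lookup a)) (trans (tabulate-cong a≗b) (tabulate∘lookup b))

-- The injection from CSL-classes to σ-classes

module Comparison {k : ℕ} (3≤k : 3 ≤ k) (σ : Permutation′ (suc k)) (cyclic : IsCyclic σ)
            (σ≢csl : ¬ (∀ i → σ ⟨$⟩ʳ i ≡ csl i)) where

  private
    V : Set
    V = Vector (Fin (suc k)) (suc k)
    1≤k : 1 ≤ k
    1≤k = ≤-trans (s≤s z≤n) 3≤k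
    2≤k : 2 ≤ k
    2≤k = ≤-trans (s≤s (s≤s z≤n)) 3≤k

  h : Fin (suc k) → Fin (suc k)
  h = σ ⟨$⟩ˡ_

  module Roundsσ   = ThreeRounds (σ ⟨$⟩ʳ_) h (λ _ → inverseʳ σ) (λ _ → inverseˡ σ)
  module RoundsCSL = ThreeRounds {k} csl cs csl-cs cs-csl

  h-moves : ∀ x → h x ≢ x
  h-moves x hx≡x = cyclic-no-fixed-point cyclic 1≤k x (trans (cong (σ ⟨$⟩ʳ_) (sym hx≡x)) (inverseʳ σ))

  hh-moves : ∀ x → h (h x) ≢ x
  hh-moves x hhx≡x = cyclic-no-2-cycle cyclic 2≤k x (trans (cong (σ ⟨$⟩ʳ_) σx≡hx) (inverseʳ σ))
    where
    σx≡hx : σ ⟨$⟩ʳ x ≡ h x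
    σx≡hx = trans (cong (σ ⟨$⟩ʳ_) (sym hhx≡x)) (inverseʳ σ)

  h≢cs : ∃ λ x → h x ≢ cs x
  h≢cs with any? (λ x → ¬? (h x ≟ cs x))
  ... | yes found = found
  ... | no ¬found = ⊥-elim (σ≢csl λ i → trans (cong (σ ⟨$⟩ʳ_) (sym (trans (h≡cs (csl i)) (cs-csl i)))) (inverseʳ σ))
    where
    h≡cs : ∀ x → h x ≡ cs x
    h≡cs x = decidable-stable (h x ≟ cs x) (λ hx≢cx → ¬found (x , hx≢cx))

  h-injective : ∀ {x y} → h x ≡ h y → x ≡ y
  h-injective = Roundsσ.h-injective

  extend-outside : {P : Pred (Fin (suc k)) 0ℓ} (P? : Decidable P) → TwoIn P → Avoids cs P →
                   ∃ λ z → ¬ Extension.extend h P z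
  extend-outside {P} P? two avoids =
    Extension.extend-nonfull h P P? 2≤k (λ _ → inverseʳ σ) cyclic avoids (TwoIn.fst∈ two)

  shifted-ends : {P : Pred (Fin (suc k)) 0ℓ} (P? : Decidable P) → TwoIn P → Avoids cs P →
                 Ends3Perm (indStrat (suc k) (σ ⟨$⟩ʳ_)) (shiftOn (Extension.extend? h P P?) h) ×
                 Derangement (shiftOn (Extension.extend? h P P?) h)
  shifted-ends {P} P? two avoids =
    Roundsσ.shiftOn-Ends3 h-moves (Extension.extend? h P P?) (TwoIn-⊆ inj₁ two) (extend-outside P? two avoids)
      (Extension.extend-avoids h P P? 1≤k h-injective avoids)

  E : V → Pred (Fin (suc k)) 0ℓ
  E π = Extension.extend h (RoundsCSL.Wrong₂ π)

  E? : (π : V) → Decidable (E π)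
  E? π = Extension.extend? h (RoundsCSL.Wrong₂ π) (RoundsCSL.wrong₂? π)

  image : V → V
  image π with any? (λ q → π q ≟ q) | all? (RoundsCSL.wrong₂? π)
  ... | yes _ | _     = π
  ... | no _  | yes _ = λ x → h (h x)
  ... | no _  | no _  = shiftOn (E? π) h

  data Class (π : V) : V → Set where
    fixed   : (∃ λ q → π q ≡ q) → Class π π
    full    : (∀ x → π x ≡ cs (cs x)) → Class π (λ x → h (h x))
    partial : TwoIn (RoundsCSL.Wrong₂ π) → Avoids cs (RoundsCSL.Wrong₂ π) →
              (∀ x → π x ≡ shiftOn (RoundsCSL.wrong₂? π) cs x) → Class π (shiftOn (E? π) h)

  ¬fixed⇒derangement : {π : V} → ¬ (∃ λ q → π q ≡ q) → Derangement π
  ¬fixed⇒derangement ¬fixed x πx≡x = ¬fixed (x , πx≡x)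

  classify : ∀ π → Ends3 (CSL (suc k)) π → Class π (image π)
  classify π ends with any? (λ q → π q ≟ q) | all? (RoundsCSL.wrong₂? π)
  ... | yes fixed-point | _             = fixed fixed-point
  ... | no ¬fixed       | yes all-wrong = full (RoundsCSL.Ends3-full⇒ (¬fixed⇒derangement ¬fixed) ends all-wrong)
  ... | no ¬fixed       | no ¬all-wrong = partial two avoids (shiftOn-unique (RoundsCSL.wrong₂? π) cs two π right-outside shape)
    where
    der : Derangement π
    der = ¬fixed⇒derangement ¬fixed
    right-outside : ∀ {x} → ¬ RoundsCSL.Wrong₂ π x → π x ≡ cs x
    right-outside {x} ¬wrong = sym (decidable-stable (cs x ≟ π x) ¬wrong)
    right : ∃ λ x → cs x ≡ π x
    right = let (x , ¬wrong) = ¬∀⟶∃¬ (suc k) _ (RoundsCSL.wrong₂? π) ¬all-wrong in x , sym (right-outside ¬wrong)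
    two : TwoIn (RoundsCSL.Wrong₂ π)
    two = proj₁ (RoundsCSL.Ends3-partial⇒ der ends right)
    shape : ∀ {a b} → NextIn (RoundsCSL.Wrong₂ π) a b → π b ≡ cs a
    shape = proj₂ (RoundsCSL.Ends3-partial⇒ der ends right)
    avoids : Avoids cs (RoundsCSL.Wrong₂ π)
    avoids ab b≡ca = der _ (trans (shape ab) (sym b≡ca))

  class-ends : ∀ {π φ} → Class π φ → Ends3Perm (CSL (suc k)) π → Ends3Perm (indStrat (suc k) (σ ⟨$⟩ʳ_)) φ
  class-ends {π} (fixed (q , πq≡q)) (ends3Perm perm ends) =
    ends3Perm perm (Ends3-transport (guess-indStrat-fixed csl (σ ⟨$⟩ʳ_) π πq≡q) (λ _ → refl) ends)
  class-ends (full _) _ = proj₁ (Roundsσ.hh-Ends3 h-moves hh-moves)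
  class-ends {π} (partial two avoids _) _ = proj₁ (shifted-ends (RoundsCSL.wrong₂? π) two avoids)

  fixed-vs-derangement : ∀ {π φ : V} {q} → π q ≡ q → Derangement φ → ¬ (∀ x → π x ≡ φ x)
  fixed-vs-derangement {q = q} πq≡q der π≗φ = der q (trans (sym (π≗φ q)) πq≡q)

  hh-vs-shifted : ∀ {E : Pred (Fin (suc k)) 0ℓ} (E? : Decidable E) → ∃ (λ z → ¬ E z) → ¬ (∀ x → h (h x) ≡ shiftOn E? h x)
  hh-vs-shifted E? (z , ¬ez) same = h-moves z (h-injective (trans (same z) (shiftOn-outside E? h ¬ez)))

  partial-injective : ∀ {π₁ π₂ : V} → TwoIn (RoundsCSL.Wrong₂ π₁) → Avoids cs (RoundsCSL.Wrong₂ π₁) →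
                      TwoIn (RoundsCSL.Wrong₂ π₂) → Avoids cs (RoundsCSL.Wrong₂ π₂) →
                      (∀ x → shiftOn (E? π₁) h x ≡ shiftOn (E? π₂) h x) →
                      ∀ x → shiftOn (RoundsCSL.wrong₂? π₁) cs x ≡ shiftOn (RoundsCSL.wrong₂? π₂) cs x
  partial-injective {π₁} {π₂} two₁ avoids₁ two₂ avoids₂ same =
    shiftOn-cong (RoundsCSL.wrong₂? π₁) (RoundsCSL.wrong₂? π₂) cs two₁ Q₁⊆Q₂ Q₂⊆Q₁
    where
    E₁⊆E₂ : E π₁ ⊆ E π₂
    E₁⊆E₂ = shiftOn-reflects-⊆ (E? π₁) (E? π₂) h (TwoIn-⊆ inj₁ two₁) h-injective same
    E₂⊆E₁ : E π₂ ⊆ E π₁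
    E₂⊆E₁ = shiftOn-reflects-⊆ (E? π₂) (E? π₁) h (TwoIn-⊆ inj₁ two₂) h-injective (λ x → sym (same x))
    Q₁⊆Q₂ : RoundsCSL.Wrong₂ π₁ ⊆ RoundsCSL.Wrong₂ π₂
    Q₁⊆Q₂ = extend-injective h 1≤k (RoundsCSL.wrong₂? π₂) avoids₁ avoids₂ E₁⊆E₂ E₂⊆E₁
              (extend-outside (RoundsCSL.wrong₂? π₁) two₁ avoids₁)
    Q₂⊆Q₁ : RoundsCSL.Wrong₂ π₂ ⊆ RoundsCSL.Wrong₂ π₁
    Q₂⊆Q₁ = extend-injective h 1≤k (RoundsCSL.wrong₂? π₁) avoids₂ avoids₁ E₂⊆E₁ E₁⊆E₂
              (extend-outside (RoundsCSL.wrong₂? π₂) two₂ avoids₂)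

  class-injective : ∀ {π₁ φ₁ π₂ φ₂ : V} → Class π₁ φ₁ → Class π₂ φ₂ → (∀ x → φ₁ x ≡ φ₂ x) → ∀ x → π₁ x ≡ π₂ x
  class-injective (fixed _) (fixed _) same = same
  class-injective (fixed (_ , fixed-q)) (full _) same = ⊥-elim (fixed-vs-derangement fixed-q hh-moves same)
  class-injective (full _) (fixed (_ , fixed-q)) same =
    ⊥-elim (fixed-vs-derangement fixed-q hh-moves (λ x → sym (same x)))
  class-injective {π₂ = π₂} (fixed (_ , fixed-q)) (partial two avoids _) same =
    ⊥-elim (fixed-vs-derangement fixed-q (proj₂ (shifted-ends (RoundsCSL.wrong₂? π₂) two avoids)) same)
  class-injective {π₁} (partial two avoids _) (fixed (_ , fixed-q)) same =
    ⊥-elim (fixed-vs-derangement fixed-q (proj₂ (shifted-ends (RoundsCSL.wrong₂? π₁) two avoids)) (λ x → sym (same x)))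
  class-injective (full π₁≗) (full π₂≗) _ x = trans (π₁≗ x) (sym (π₂≗ x))
  class-injective {π₂ = π₂} (full _) (partial two avoids _) same =
    ⊥-elim (hh-vs-shifted (E? π₂) (extend-outside (RoundsCSL.wrong₂? π₂) two avoids) same)
  class-injective {π₁} (partial two avoids _) (full _) same =
    ⊥-elim (hh-vs-shifted (E? π₁) (extend-outside (RoundsCSL.wrong₂? π₁) two avoids) (λ x → sym (same x)))
  class-injective (partial two₁ avoids₁ π₁≗) (partial two₂ avoids₂ π₂≗) same x =
    trans (π₁≗ x) (trans (partial-injective two₁ avoids₁ two₂ avoids₂ same x) (sym (π₂≗ x)))

  open Witness (witness 3≤k h h-injective h≢cs)

  missed : V
  missed = shiftOn W? h

  missed-ends : Ends3Perm (indStrat (suc k) (σ ⟨$⟩ʳ_)) missed × Derangement missed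
  missed-ends = Roundsσ.shiftOn-Ends3 h-moves W? two (outside , ¬W-outside) avoids

  class-misses : ∀ {π φ : V} → Class π φ → ¬ (∀ x → φ x ≡ missed x)
  class-misses (fixed (_ , fixed-q)) same = fixed-vs-derangement fixed-q (proj₂ missed-ends) same
  class-misses (full _) same = hh-vs-shifted W? (outside , ¬W-outside) same
  class-misses {π} (partial two′ avoids′ _) same = not-extension avoids′ E⊆W W⊆E two′
    where
    E⊆W : E π ⊆ W
    E⊆W = shiftOn-reflects-⊆ (E? π) W? h (TwoIn-⊆ inj₁ two′) h-injective same
    W⊆E : W ⊆ E π
    W⊆E = shiftOn-reflects-⊆ W? (E? π) h two h-injective (λ x → sym (same x))

  coeff3-CSL<σ : coeff3 (suc k) (CSL (suc k)) < coeff3 (suc k) (indStrat (suc k) (σ ⟨$⟩ʳ_))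
  coeff3-CSL<σ = coeff3-< (suc k) (CSL (suc k)) (indStrat (suc k) (σ ⟨$⟩ʳ_)) image
    (λ e → class-ends (classify _ (Ends3Perm.ends3 e)) e)
    (λ e₁ e₂ → class-injective (classify _ (Ends3Perm.ends3 e₁)) (classify _ (Ends3Perm.ends3 e₂)))
    missed (proj₁ missed-ends) (λ e → class-misses (classify _ (Ends3Perm.ends3 e)))

theorem4p9 : (n : ℕ) → 4 ≤ n → (σ : Permutation′ n) → IsCyclic σ →
    ¬ (∀ i → σ ⟨$⟩ʳ i ≡ csl i) →
    coeff3 n (CSL n) < coeff3 n (indStrat n (σ ⟨$⟩ʳ_))
theorem4p9 (suc k) (s≤s 3≤k) σ cyclic σ≢csl = Comparison.coeff3-CSL<σ 3≤k σ cyclic σ≢csl
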